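{- Let $q$ be an odd prime power, $A=\mathbb F_q[T]$, $a\in A$, $r\in A$ monic with $\gcd(r,a)=1$, $\ell\in A$ monic irreducible and $k\ge1$ an integer. Then $c(a;\ell^k,r)=c(a;\ell^k,\ell)$ if $\ell\mid r$ and $c(a;\ell^k,r)=c(a;\ell^k,1)$ if $\ell\nmid r$. More precisely, $$c(a;\ell^k,r)=\begin{cases}|\ell|^{k-1}(|\ell|-2) & k\text{ even},\ \ell\nmid a,\ \ell\nmid r,\\ -|\ell|^{k-1} & k\text{ odd},\ \ell\nmid a,\ \ell\nmid r,\\ |\ell|^{k-1}(|\ell|-1) & k\text{ even},\ \ell\mid a,\ \ell\nmid r,\\ 0 & k\text{ odd},\ \ell\mid a,\ \ell\nmid r,\\ |\ell|^{k-1}(|\ell|-1) & k\text{ even},\ \ell\mid r,\\ 0 & k\text{ odd},\ \ell\mid r.\end{cases}$$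
   Context: $|b|=q^{\deg b}$. For $\sigma\in A$ and monic $v\in A$, $\chi_\sigma(v)$ denotes the Jacobi symbol $\left(\frac{\sigma}{v}\right)$, i.e. the completely multiplicative function of $v$ whose value at a monic irreducible $\ell$ is $0$ if $\ell\mid\sigma$, $1$ if $\sigma$ is a nonzero square mod $\ell$, and $-1$ otherwise (equivalently, the character attached to the discriminant $\sigma$, which depends only on $\sigma$ mod $v$). For monic $v,r\in A$ with $\gcd(r,a)=1$, $$c(a;v,r):=\sum_{\substack{\sigma\in(A/vA)^*\\ \gcd(\sigma r^2-a^2,\,v)=1}}\chi_\sigma(v),$$ the sum over representatives of the units modulo $v$. -}

module Defs where

open import Data.Nat as ℕ using (ℕ; zero; suc; _∸_; _^_)
open import Data.Integer as ℤ using (ℤ; +_; -[1+_])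
open import Data.List using (List; []; _∷_; map; foldr; filter; concatMap; length; last)
open import Data.List.Membership.Propositional using (_∈_)
open import Data.List.Relation.Unary.Unique.Propositional using (Unique)
open import Data.Maybe using (just)
open import Data.Product using (∃; _×_)
open import Algebra.Core using (Op₁; Op₂)
open import Algebra.Structures using (IsCommutativeRing)
open import Relation.Binary.PropositionalEquality using (_≡_; _≢_)
open import Relation.Binary.Definitions using (DecidableEquality)
open import Relation.Nullary using (¬_; Dec; yes; no)

record FiniteField : Set₁ where
  field
    Carrier   : Set
    _≟_       : DecidableEquality Carrier
    0# 1#     : Carrier
    _+_ _*_   : Op₂ Carrier
    -_        : Op₁ Carrier
    isCommutativeRing : IsCommutativeRing _≡_ _+_ _*_ -_ 0# 1#
    0≢1       : 0# ≢ 1#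
    inverse   : ∀ x → x ≢ 0# → ∃ λ y → x * y ≡ 1#
    elements  : List Carrier
    complete  : ∀ x → x ∈ elements
    unique    : Unique elements

  q : ℕ
  q = length elements

-- Polynomials A = F[T] over a finite field F, represented as coefficient lists
-- (constant coefficient first).  All arithmetic operations return normalised
-- lists (no trailing zero coefficients); the zero polynomial is [].
module Poly (F : FiniteField) where
  open FiniteField F

  Pol : Set
  Pol = List Carrier

  strip : Pol → Pol
  strip [] = []
  strip (x ∷ xs) with strip xs
  ... | y ∷ ys = x ∷ y ∷ ys
  ... | [] with x ≟ 0#
  ...   | yes _ = []
  ...   | no _  = x ∷ []

  addL : Pol → Pol → Pol
  addL [] g = g
  addL (x ∷ f) [] = x ∷ f
  addL (x ∷ f) (y ∷ g) = (x + y) ∷ addL f g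

  mulL : Pol → Pol → Pol
  mulL [] g = []
  mulL (c ∷ f) g = addL (map (c *_) g) (0# ∷ mulL f g)

  oneP : Pol
  oneP = 1# ∷ []

  _+P_ : Pol → Pol → Pol
  f +P g = strip (addL f g)

  negP : Pol → Pol
  negP f = strip (map -_ f)

  _-P_ : Pol → Pol → Pol
  f -P g = f +P negP g

  _*P_ : Pol → Pol → Pol
  f *P g = strip (mulL f g)

  _^P_ : Pol → ℕ → Pol
  f ^P zero = oneP
  f ^P suc n = f *P (f ^P n)

  _≈P_ : Pol → Pol → Set
  f ≈P g = strip f ≡ strip g

  _∣P_ : Pol → Pol → Set
  f ∣P g = ∃ λ h → (f *P h) ≈P g

  Monic : Pol → Set
  Monic f = last f ≡ just 1#

  deg : Pol → ℕ
  deg f = length (strip f) ∸ 1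

  ∣_∣P : Pol → ℕ
  ∣ f ∣P = q ^ deg f

  MonicIrreducible : Pol → Set
  MonicIrreducible ℓ =
    Monic ℓ × (¬ (ℓ ≈P oneP)) × (∀ d → Monic d → d ∣P ℓ → (d ≈P oneP) ⊎' (d ≈P ℓ))
    where
      open import Data.Sum renaming (_⊎_ to _⊎'_)

  Coprime : Pol → Pol → Set
  Coprime x v = ∀ d → Monic d → d ∣P x → d ∣P v → d ≈P oneP

  NonzeroSquareMod : Pol → Pol → Set
  NonzeroSquareMod σ ℓ = (¬ (ℓ ∣P σ)) × (∃ λ y → ℓ ∣P (σ -P (y *P y)))

  -- χ : A → A → ℤ, with χ σ v standing for the Jacobi symbol (σ / v), is the
  -- Jacobi symbol: completely multiplicative in monic v, with the prescribed
  -- values at monic irreducibles.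
  record IsJacobi (χ : Pol → Pol → ℤ) : Set where
    field
      at-irr-div : ∀ σ ℓ → MonicIrreducible ℓ → ℓ ∣P σ → χ σ ℓ ≡ + 0
      at-irr-sq  : ∀ σ ℓ → MonicIrreducible ℓ → NonzeroSquareMod σ ℓ → χ σ ℓ ≡ + 1
      at-irr-nsq : ∀ σ ℓ → MonicIrreducible ℓ → ¬ (ℓ ∣P σ) → ¬ NonzeroSquareMod σ ℓ → χ σ ℓ ≡ -[1+ 0 ]
      at-one     : ∀ σ → χ σ oneP ≡ + 1
      mult       : ∀ σ u v → Monic u → Monic v → χ σ (u *P v) ≡ ℤ._*_ (χ σ u) (χ σ v)

  allLists : ℕ → List Pol
  allLists zero = [] ∷ []
  allLists (suc n) = concatMap (λ x → map (x ∷_) (allLists n)) elements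

  -- canonical representatives of A / vA (v monic): polynomials of degree < deg v
  residues : Pol → List Pol
  residues v = map strip (allLists (deg v))

  sumℤ : List ℤ → ℤ
  sumℤ = foldr ℤ._+_ (+ 0)

  -- c(a; v, r) = Σ_{σ ∈ (A/vA)^*, gcd(σ r² − a², v) = 1} χ_σ(v),
  -- given a decision procedure for Coprime (any two give the same value)
  -- and the Jacobi symbol χ.
  cSum : (coprime? : ∀ x v → Dec (Coprime x v)) → (χ : Pol → Pol → ℤ) →
         Pol → Pol → Pol → ℤ
  cSum coprime? χ a v r =
    sumℤ (map (λ σ → χ σ v)
      (filter (λ σ → coprime? σ v) (filter (λ σ → coprime? ((σ *P (r *P r)) -P (a *P a)) v) (residues v))))

module Submission where

-- The summand χ_σ(ℓ^k) = χ_σ(ℓ)^k and both coprimality conditions depend only on σ mod ℓ, so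
-- c(a; ℓ^k, r) is |ℓ|^(k-1) times the analogous sum over residues σ mod ℓ, where χ_σ(ℓ) is the
-- Legendre symbol. If ℓ ∣ r then ℓ ∤ a and σr² - a² is always a unit; if ℓ ∣ a (and ℓ ∤ r) it is a
-- unit exactly when σ is; otherwise it is a unit for every σ except σ ≡ (a/r)², a nonzero square.
-- What remains is Σ_{ℓ ∤ σ} (σ/ℓ)^k, which is |ℓ| - 1 for even k and 0 for odd k: in odd
-- characteristic each nonzero square has exactly two square roots, so half the units are squares.

open import Algebra.Bundles using (CommutativeRing)
import Algebra.Solver.Ring.AlmostCommutativeRing as ACR
open import Data.Integer as ℤ using (ℤ; +_; -[1+_])
import Data.Integer.Properties as ℤ
open import Data.Maybe using (Maybe; just; nothing)
open import Data.Nat as ℕ using (ℕ; zero; suc; _≤_; _<_; z≤n; s≤s; _∸_; _^_; _%_)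
import Data.Nat.Properties as ℕ
open import Data.Sign as Sign using (Sign)
open import Data.Sum as Sum using (_⊎_; inj₁; inj₂; [_,_])
import Relation.Binary.PropositionalEquality as ≡
open import Relation.Nullary using (¬_; Dec; yes; no; does)

-- Algebra.Solver.Ring needs a coefficient ring with decidable equality and a morphism into the
-- target; ℤ, being initial, serves every commutative ring.
module ℤ-RingSolver {c ℓ} (R : CommutativeRing c ℓ) where
  open CommutativeRing R
  open import Algebra.Properties.Ring ring using (-‿distribˡ-*; -‿distribʳ-*)
  open import Algebra.Properties.AbelianGroup +-abelianGroup using (⁻¹-∙-comm; ε⁻¹≈ε; ⁻¹-involutive)
  open import Algebra.Properties.Semiring.Mult semiring using (_×_; ×-homo-+; ×1-homo-*)
  open import Relation.Binary.Reasoning.Setoid setoid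

  private
    fromℕ : ℕ → Carrier
    fromℕ n = n × 1#

    signed : Sign → ℕ → Carrier
    signed Sign.+ n = fromℕ n
    signed Sign.- n = - fromℕ n

    fromℤ : ℤ → Carrier
    fromℤ (+ n) = fromℕ n
    fromℤ -[1+ n ] = - fromℕ (suc n)

    fromℤ-◃ : ∀ s n → fromℤ (s ℤ.◃ n) ≈ signed s n
    fromℤ-◃ Sign.+ zero = refl
    fromℤ-◃ Sign.- zero = sym ε⁻¹≈ε
    fromℤ-◃ Sign.+ (suc n) = refl
    fromℤ-◃ Sign.- (suc n) = refl

    fromℤ-signAbs : ∀ i → fromℤ i ≈ signed (ℤ.sign i) ℤ.∣ i ∣
    fromℤ-signAbs (+ n) = refl
    fromℤ-signAbs -[1+ n ] = refl

    signed-* : ∀ s t m n → signed (s Sign.* t) (m ℕ.* n) ≈ signed s m * signed t n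
    signed-* Sign.+ Sign.+ m n = ×1-homo-* m n
    signed-* Sign.+ Sign.- m n = trans (-‿cong (×1-homo-* m n)) (-‿distribʳ-* _ _)
    signed-* Sign.- Sign.+ m n = trans (-‿cong (×1-homo-* m n)) (-‿distribˡ-* _ _)
    signed-* Sign.- Sign.- m n = begin
      fromℕ (m ℕ.* n)             ≈⟨ ×1-homo-* m n ⟩
      fromℕ m * fromℕ n           ≈⟨ ⁻¹-involutive _ ⟨
      - - (fromℕ m * fromℕ n)     ≈⟨ -‿cong (-‿distribˡ-* _ _) ⟩
      - (- fromℕ m * fromℕ n)     ≈⟨ -‿distribʳ-* _ _ ⟩
      - fromℕ m * - fromℕ n       ∎

    fromℤ-neg : ∀ i → fromℤ (ℤ.- i) ≈ - fromℤ i
    fromℤ-neg (+ zero) = sym ε⁻¹≈ε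
    fromℤ-neg (+ suc n) = refl
    fromℤ-neg -[1+ n ] = sym (⁻¹-involutive _)

    fromℤ-⊖ : ∀ m n → fromℤ (m ℤ.⊖ n) ≈ fromℕ m - fromℕ n
    fromℤ-⊖ m n with ℕ.≤-total n m
    ... | inj₁ n≤m = begin
      fromℤ (m ℤ.⊖ n)                         ≡⟨ ≡.cong fromℤ (ℤ.⊖-≥ n≤m) ⟩
      fromℕ (m ℕ.∸ n)                         ≈⟨ +-identityʳ _ ⟨
      fromℕ (m ℕ.∸ n) + 0#                    ≈⟨ +-congˡ (-‿inverseʳ _) ⟨
      fromℕ (m ℕ.∸ n) + (fromℕ n - fromℕ n)   ≈⟨ +-assoc _ _ _ ⟨
      fromℕ (m ℕ.∸ n) + fromℕ n - fromℕ n     ≈⟨ +-congʳ (×-homo-+ 1# (m ℕ.∸ n) n) ⟨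
      fromℕ (m ℕ.∸ n ℕ.+ n) - fromℕ n         ≡⟨ ≡.cong (λ k → fromℕ k - fromℕ n) (ℕ.m∸n+n≡m n≤m) ⟩
      fromℕ m - fromℕ n                       ∎
    ... | inj₂ m≤n = begin
      fromℤ (m ℤ.⊖ n)                         ≡⟨ ≡.cong fromℤ (ℤ.⊖-≤ m≤n) ⟩
      fromℤ (ℤ.- (+ (n ℕ.∸ m)))               ≈⟨ fromℤ-neg (+ (n ℕ.∸ m)) ⟩
      - fromℕ (n ℕ.∸ m)                       ≈⟨ +-identityˡ _ ⟨
      0# - fromℕ (n ℕ.∸ m)                    ≈⟨ +-congʳ (-‿inverseʳ _) ⟨
      fromℕ m - fromℕ m - fromℕ (n ℕ.∸ m)     ≈⟨ +-assoc _ _ _ ⟩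
      fromℕ m + (- fromℕ m - fromℕ (n ℕ.∸ m)) ≈⟨ +-congˡ (⁻¹-∙-comm _ _) ⟩
      fromℕ m - (fromℕ m + fromℕ (n ℕ.∸ m))   ≈⟨ +-congˡ (-‿cong (×-homo-+ 1# m (n ℕ.∸ m))) ⟨
      fromℕ m - fromℕ (m ℕ.+ (n ℕ.∸ m))       ≡⟨ ≡.cong (λ k → fromℕ m - fromℕ k) (ℕ.m+[n∸m]≡n m≤n) ⟩
      fromℕ m - fromℕ n                       ∎

    fromℤ-+ : ∀ i j → fromℤ (i ℤ.+ j) ≈ fromℤ i + fromℤ j
    fromℤ-+ -[1+ m ] -[1+ n ] = begin
      - (1# + fromℕ (suc (m ℕ.+ n)))     ≈⟨ -‿cong (+-congˡ (×-homo-+ 1# (suc m) n)) ⟩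
      - (1# + (fromℕ (suc m) + fromℕ n)) ≈⟨ -‿cong (trans (sym (+-assoc _ _ _)) (trans (+-congʳ (+-comm _ _)) (+-assoc _ _ _))) ⟩
      - (fromℕ (suc m) + fromℕ (suc n))  ≈⟨ ⁻¹-∙-comm _ _ ⟨
      - fromℕ (suc m) - fromℕ (suc n)    ∎
    fromℤ-+ -[1+ m ] (+ n) = trans (fromℤ-⊖ n (suc m)) (+-comm _ _)
    fromℤ-+ (+ m) -[1+ n ] = fromℤ-⊖ m (suc n)
    fromℤ-+ (+ m) (+ n) = ×-homo-+ 1# m n

    fromℤ-* : ∀ i j → fromℤ (i ℤ.* j) ≈ fromℤ i * fromℤ j
    fromℤ-* i j = begin
      fromℤ (i ℤ.* j)                                      ≈⟨ fromℤ-◃ (ℤ.sign i Sign.* ℤ.sign j) (ℤ.∣ i ∣ ℕ.* ℤ.∣ j ∣) ⟩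
      signed (ℤ.sign i Sign.* ℤ.sign j) (ℤ.∣ i ∣ ℕ.* ℤ.∣ j ∣) ≈⟨ signed-* (ℤ.sign i) (ℤ.sign j) ℤ.∣ i ∣ ℤ.∣ j ∣ ⟩
      signed (ℤ.sign i) ℤ.∣ i ∣ * signed (ℤ.sign j) ℤ.∣ j ∣  ≈⟨ *-cong (fromℤ-signAbs i) (fromℤ-signAbs j) ⟨
      fromℤ i * fromℤ j                                    ∎

    almostCommutativeRing : ACR.AlmostCommutativeRing c ℓ
    almostCommutativeRing = ACR.fromCommutativeRing R

    fromℤ-morphism : ACR._-Raw-AlmostCommutative⟶_ (CommutativeRing.rawRing ℤ.+-*-commutativeRing) almostCommutativeRing
    fromℤ-morphism = record
      { ⟦_⟧ = fromℤ ; +-homo = fromℤ-+ ; *-homo = fromℤ-* ; -‿homo = fromℤ-neg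
      ; 0-homo = refl ; 1-homo = +-identityʳ _ }

    fromℤ-≈? : ∀ i j → Maybe (fromℤ i ≈ fromℤ j)
    fromℤ-≈? i j with i ℤ.≟ j
    ... | yes ≡.refl = just refl
    ... | no _ = nothing

  open import Algebra.Solver.Ring (CommutativeRing.rawRing ℤ.+-*-commutativeRing) almostCommutativeRing fromℤ-morphism fromℤ-≈? public
    using (solve; _:=_; _:+_; _:*_; :-_; _:-_; con)

-- imported only here: the `open CommutativeRing R` above would clash with these names
open import Defs
open import Algebra.Structures using (IsCommutativeRing)
open import Data.Bool using (true; false; if_then_else_)
open import Data.Empty using (⊥-elim)
open import Data.Integer.Solver using (module +-*-Solver)
open import Data.List using (List; []; _∷_; map; length; last; filter; foldr; concatMap; _++_; cartesianProduct; cartesianProductWith)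
import Data.List.Properties as List
open import Data.List.Membership.Propositional using (_∈_)
import Data.List.Membership.Propositional.Properties as ∈
open import Data.List.Relation.Unary.All as All using (All; [])
open import Data.List.Relation.Unary.AllPairs using ([]; _∷_)
open import Data.List.Relation.Unary.Any as Any using (here; there; any?)
open import Data.List.Relation.Unary.Unique.Propositional using (Unique)
import Data.List.Relation.Unary.Unique.Propositional.Properties as Unique
open import Data.Nat.DivMod using (m*n%n≡0; m≡m%n+[m/n]*n)
open import Data.Product using (Σ; ∃; _×_; _,_; proj₁; proj₂)
open import Function using (_∘_)
open import Relation.Binary.PropositionalEquality
open import Relation.Nullary.Decidable using (¬?; map′)
open import Relation.Unary using (Pred; Decidable)

∑ : {A : Set} → (A → ℤ) → List A → ℤ
∑ g [] = + 0
∑ g (x ∷ xs) = g x ℤ.+ ∑ g xs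

when : {P : Set} → Dec P → ℤ → ℤ
when p z = if does p then z else + 0

when-yes : ∀ {P : Set} (p : Dec P) → P → ∀ z → when p z ≡ z
when-yes (yes _) _ z = refl
when-yes (no ¬p) p z = ⊥-elim (¬p p)

when-idem : ∀ {P : Set} (p : Dec P) z → when p (when p z) ≡ when p z
when-idem (yes _) z = refl
when-idem (no _) z = refl

when-⇔ : ∀ {P Q : Set} (p : Dec P) (q : Dec Q) → (P → Q) → (Q → P) → ∀ z → when p z ≡ when q z
when-⇔ (yes _) (yes _) _ _ z = refl
when-⇔ (no _) (no _) _ _ z = refl
when-⇔ (yes p) (no ¬q) to _ z = ⊥-elim (¬q (to p))
when-⇔ (no ¬p) (yes q) _ from z = ⊥-elim (¬p (from q))

when-⊎ : ∀ {P Q R : Set} (p : Dec P) (q : Dec Q) (r : Dec R) → (P → Q ⊎ R) → (Q ⊎ R → P) → ¬ (Q × R) →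
         when p (+ 1) ≡ when q (+ 1) ℤ.+ when r (+ 1)
when-⊎ (yes _) (yes q) (yes r) _ _ ¬q×r = ⊥-elim (¬q×r (q , r))
when-⊎ (yes _) (yes _) (no _) _ _ _ = refl
when-⊎ (yes _) (no _) (yes _) _ _ _ = refl
when-⊎ (yes p) (no ¬q) (no ¬r) to _ _ = ⊥-elim ([_,_] ¬q ¬r (to p))
when-⊎ (no ¬p) (yes q) _ _ from _ = ⊥-elim (¬p (from (inj₁ q)))
when-⊎ (no ¬p) (no _) (yes r) _ from _ = ⊥-elim (¬p (from (inj₂ r)))
when-⊎ (no _) (no _) (no _) _ _ _ = refl

module _ {A : Set} where
  open +-*-Solver

  sumℤ-map : ∀ (g : A → ℤ) xs → foldr ℤ._+_ (+ 0) (map g xs) ≡ ∑ g xs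
  sumℤ-map g [] = refl
  sumℤ-map g (x ∷ xs) = cong (λ s → g x ℤ.+ s) (sumℤ-map g xs)

  ∑-filter : ∀ {P : Pred A _} (P? : Decidable P) (g : A → ℤ) xs → ∑ g (filter P? xs) ≡ ∑ (λ x → when (P? x) (g x)) xs
  ∑-filter P? g [] = refl
  ∑-filter P? g (x ∷ xs) with does (P? x)
  ... | true = cong (λ s → g x ℤ.+ s) (∑-filter P? g xs)
  ... | false = trans (∑-filter P? g xs) (sym (ℤ.+-identityˡ _))

  ∑-cong : ∀ {g h : A → ℤ} xs → (∀ x → x ∈ xs → g x ≡ h x) → ∑ g xs ≡ ∑ h xs
  ∑-cong [] p = refl
  ∑-cong (x ∷ xs) p = cong₂ ℤ._+_ (p x (here refl)) (∑-cong xs (λ y y∈xs → p y (there y∈xs)))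

  ∑-+ : ∀ (g h : A → ℤ) xs → ∑ (λ x → g x ℤ.+ h x) xs ≡ ∑ g xs ℤ.+ ∑ h xs
  ∑-+ g h [] = refl
  ∑-+ g h (x ∷ xs) rewrite ∑-+ g h xs =
    solve 4 (λ a b c d → (a :+ b) :+ (c :+ d) := (a :+ c) :+ (b :+ d)) refl (g x) (h x) (∑ g xs) (∑ h xs)

  ∑-* : ∀ (c : ℤ) (g : A → ℤ) xs → ∑ (λ x → c ℤ.* g x) xs ≡ c ℤ.* ∑ g xs
  ∑-* c g [] = sym (ℤ.*-zeroʳ c)
  ∑-* c g (x ∷ xs) rewrite ∑-* c g xs = sym (ℤ.*-distribˡ-+ c (g x) (∑ g xs))

  ∑-neg : ∀ (g : A → ℤ) xs → ∑ (λ x → ℤ.- g x) xs ≡ ℤ.- ∑ g xs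
  ∑-neg g [] = refl
  ∑-neg g (x ∷ xs) rewrite ∑-neg g xs = sym (ℤ.neg-distrib-+ (g x) (∑ g xs))

  ∑-const : ∀ (c : ℤ) xs → ∑ (λ (_ : A) → c) xs ≡ + length xs ℤ.* c
  ∑-const c [] = sym (ℤ.*-zeroˡ c)
  ∑-const c (x ∷ xs) rewrite ∑-const c xs = solve 2 (λ c n → c :+ n :* c := (con (+ 1) :+ n) :* c) refl c (+ length xs)

  ∑-zero : ∀ (g : A → ℤ) xs → (∀ x → x ∈ xs → g x ≡ + 0) → ∑ g xs ≡ + 0
  ∑-zero g xs g≡0 = trans (∑-cong xs g≡0) (trans (∑-const (+ 0) xs) (ℤ.*-zeroʳ (+ length xs)))

  ∑-++ : ∀ (g : A → ℤ) xs ys → ∑ g (xs ++ ys) ≡ ∑ g xs ℤ.+ ∑ g ys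
  ∑-++ g [] ys = sym (ℤ.+-identityˡ _)
  ∑-++ g (x ∷ xs) ys rewrite ∑-++ g xs ys = sym (ℤ.+-assoc (g x) (∑ g xs) (∑ g ys))

  infixl 5 _─_
  _─_ : ∀ {x} xs → x ∈ xs → List A
  (y ∷ xs) ─ here _ = xs
  (y ∷ xs) ─ there x∈xs = y ∷ (xs ─ x∈xs)

  ∑-─ : ∀ (g : A → ℤ) {x} xs (x∈xs : x ∈ xs) → ∑ g xs ≡ g x ℤ.+ ∑ g (xs ─ x∈xs)
  ∑-─ g (y ∷ xs) (here refl) = refl
  ∑-─ g (y ∷ xs) (there x∈xs) rewrite ∑-─ g xs x∈xs =
    solve 3 (λ a b c → a :+ (b :+ c) := b :+ (a :+ c)) refl (g y) (g _) (∑ g (xs ─ x∈xs))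

  length-─ : ∀ {x} xs (x∈xs : x ∈ xs) → length xs ≡ ℕ.suc (length (xs ─ x∈xs))
  length-─ (y ∷ xs) (here _) = refl
  length-─ (y ∷ xs) (there x∈xs) = cong ℕ.suc (length-─ xs x∈xs)

  ∈-─⁺ : ∀ {x z} xs (x∈xs : x ∈ xs) → z ∈ xs → z ≢ x → z ∈ (xs ─ x∈xs)
  ∈-─⁺ (y ∷ xs) (here refl) (here refl) z≢x = ⊥-elim (z≢x refl)
  ∈-─⁺ (y ∷ xs) (here refl) (there z∈xs) z≢x = z∈xs
  ∈-─⁺ (y ∷ xs) (there x∈xs) (here refl) z≢x = here refl
  ∈-─⁺ (y ∷ xs) (there x∈xs) (there z∈xs) z≢x = there (∈-─⁺ xs x∈xs z∈xs z≢x)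

  ∈-─⁻ : ∀ {x z} xs (x∈xs : x ∈ xs) → z ∈ (xs ─ x∈xs) → z ∈ xs
  ∈-─⁻ (y ∷ xs) (here _) z∈ = there z∈
  ∈-─⁻ (y ∷ xs) (there x∈xs) (here refl) = here refl
  ∈-─⁻ (y ∷ xs) (there x∈xs) (there z∈) = there (∈-─⁻ xs x∈xs z∈)

  All≢⇒∉ : ∀ {x} {xs : List A} → All (x ≢_) xs → ¬ x ∈ xs
  All≢⇒∉ (x≢y All.∷ _) (here refl) = x≢y refl
  All≢⇒∉ (_ All.∷ rest) (there x∈xs) = All≢⇒∉ rest x∈xs

  unique-─ : ∀ {x} xs (x∈xs : x ∈ xs) → Unique xs → Unique (xs ─ x∈xs)
  unique-─ (y ∷ xs) (here _) (_ ∷ u) = u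
  unique-─ (y ∷ xs) (there x∈xs) (y∉ ∷ u) =
    All.tabulate (λ z∈ → All.lookup y∉ (∈-─⁻ xs x∈xs z∈)) ∷ unique-─ xs x∈xs u

  ∉-─ : ∀ {x} xs (x∈xs : x ∈ xs) → Unique xs → ¬ x ∈ (xs ─ x∈xs)
  ∉-─ (y ∷ xs) (here refl) (y∉ ∷ u) x∈ = All≢⇒∉ y∉ x∈
  ∉-─ (y ∷ xs) (there x∈xs) (y∉ ∷ u) (here refl) = All≢⇒∉ y∉ x∈xs
  ∉-─ (y ∷ xs) (there x∈xs) (y∉ ∷ u) (there x∈) = ∉-─ xs x∈xs u x∈

  ∑-⊆-unique : ∀ (g : A → ℤ) xs ys → Unique xs → Unique ys → length xs ≡ length ys →
               (∀ {x} → x ∈ xs → x ∈ ys) → ∑ g xs ≡ ∑ g ys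
  ∑-⊆-unique g [] [] _ _ _ _ = refl
  ∑-⊆-unique g (x ∷ xs) ys (x∉ ∷ ux) uy len xs⊆ys =
    trans (cong (λ s → g x ℤ.+ s) (∑-⊆-unique g xs (ys ─ x∈ys) ux (unique-─ ys x∈ys uy)
                   (ℕ.suc-injective (trans len (length-─ ys x∈ys)))
                   (λ z∈xs → ∈-─⁺ ys x∈ys (xs⊆ys (there z∈xs)) (λ { refl → All≢⇒∉ x∉ z∈xs }))))
          (sym (∑-─ g ys x∈ys))
    where x∈ys = xs⊆ys (here refl)

  ∑-indicator : ∀ (_≟_ : (a b : A) → Dec (a ≡ b)) y xs → Unique xs → y ∈ xs → ∑ (λ x → when (x ≟ y) (+ 1)) xs ≡ + 1
  ∑-indicator _≟_ y (x ∷ xs) (x∉ ∷ u) (here refl) with x ≟ x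
  ... | no x≢x = ⊥-elim (x≢x refl)
  ... | yes _ = cong (λ s → + 1 ℤ.+ s) (∑-zero _ xs others-vanish)
    where
    others-vanish : ∀ z → z ∈ xs → when (z ≟ x) (+ 1) ≡ + 0
    others-vanish z z∈xs with z ≟ x
    ... | yes refl = ⊥-elim (All≢⇒∉ x∉ z∈xs)
    ... | no _ = refl
  ∑-indicator _≟_ y (x ∷ xs) (x∉ ∷ u) (there y∈xs) with x ≟ y
  ... | yes refl = ⊥-elim (All≢⇒∉ x∉ y∈xs)
  ... | no _ = trans (ℤ.+-identityˡ _) (∑-indicator _≟_ y xs u y∈xs)

  ∑-except : ∀ (_≟_ : (a b : A) → Dec (a ≡ b)) (g h : A → ℤ) y xs → Unique xs → y ∈ xs → h y ≡ + 1 →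
             (∀ x → x ∈ xs → g x ≡ when (¬? (x ≟ y)) (h x)) → ∑ g xs ≡ ∑ h xs ℤ.- + 1
  ∑-except _≟_ g h y xs u y∈xs hy≡1 g≡ = begin
    ∑ g xs                                                     ≡⟨ ∑-cong xs pointwise ⟩
    ∑ (λ x → h x ℤ.+ ℤ.- (h y ℤ.* when (x ≟ y) (+ 1))) xs      ≡⟨ ∑-+ h _ xs ⟩
    ∑ h xs ℤ.+ ∑ (λ x → ℤ.- (h y ℤ.* when (x ≟ y) (+ 1))) xs   ≡⟨ cong (λ s → ∑ h xs ℤ.+ s) (∑-neg _ xs) ⟩
    ∑ h xs ℤ.- ∑ (λ x → h y ℤ.* when (x ≟ y) (+ 1)) xs         ≡⟨ cong (λ s → ∑ h xs ℤ.- s) (∑-* (h y) _ xs) ⟩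
    ∑ h xs ℤ.- h y ℤ.* ∑ (λ x → when (x ≟ y) (+ 1)) xs
      ≡⟨ cong (λ s → ∑ h xs ℤ.- s) (cong₂ ℤ._*_ hy≡1 (∑-indicator _≟_ y xs u y∈xs)) ⟩
    ∑ h xs ℤ.- + 1                                             ∎
    where
    open ≡-Reasoning
    pointwise : ∀ x → x ∈ xs → g x ≡ h x ℤ.+ ℤ.- (h y ℤ.* when (x ≟ y) (+ 1))
    pointwise x x∈xs with x ≟ y | g≡ x x∈xs
    ... | yes refl | gx≡ = trans gx≡ (solve 1 (λ z → con (+ 0) := z :+ :- (z :* con (+ 1))) refl (h y))
    ... | no _ | gx≡ = trans gx≡ (solve 2 (λ z w → z := z :+ :- (w :* con (+ 0))) refl (h x) (h y))

∑-map : ∀ {A B : Set} (g : B → ℤ) (φ : A → B) xs → ∑ g (map φ xs) ≡ ∑ (g ∘ φ) xs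
∑-map g φ [] = refl
∑-map g φ (x ∷ xs) = cong (λ s → g (φ x) ℤ.+ s) (∑-map g φ xs)

module _ {A B : Set} where

  unique-map : ∀ (φ : A → B) xs → Unique xs → (∀ {x y} → x ∈ xs → y ∈ xs → φ x ≡ φ y → x ≡ y) → Unique (map φ xs)
  unique-map φ [] _ _ = []
  unique-map φ (x ∷ xs) (x∉ ∷ u) inj =
    All.tabulate (λ z∈ φx≡z → φx∉ z∈ φx≡z) ∷ unique-map φ xs u (λ x∈ y∈ → inj (there x∈) (there y∈))
    where
    φx∉ : ∀ {z} → z ∈ map φ xs → φ x ≢ z
    φx∉ z∈ φx≡z with ∈.∈-map⁻ φ z∈
    ... | w , w∈xs , refl = All≢⇒∉ x∉ (subst (_∈ xs) (sym (inj (here refl) (there w∈xs) φx≡z)) w∈xs)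

  ∑-comm : ∀ (f : A → B → ℤ) xs ys → ∑ (λ y → ∑ (λ x → f x y) xs) ys ≡ ∑ (λ x → ∑ (λ y → f x y) ys) xs
  ∑-comm f [] ys = ∑-zero _ ys (λ _ _ → refl)
  ∑-comm f (x ∷ xs) ys = trans (∑-+ (f x) (λ y → ∑ (λ x' → f x' y) xs) ys) (cong (λ s → ∑ (f x) ys ℤ.+ s) (∑-comm f xs ys))

  ∑-cartesianProduct : ∀ (g : A → ℤ) xs (ys : List B) → ∑ (g ∘ proj₁) (cartesianProduct xs ys) ≡ + length ys ℤ.* ∑ g xs
  ∑-cartesianProduct g [] ys = sym (ℤ.*-zeroʳ (+ length ys))
  ∑-cartesianProduct g (x ∷ xs) ys = begin
    ∑ (g ∘ proj₁) (map (x ,_) ys ++ cartesianProduct xs ys)                  ≡⟨ ∑-++ (g ∘ proj₁) (map (x ,_) ys) _ ⟩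
    ∑ (g ∘ proj₁) (map (x ,_) ys) ℤ.+ ∑ (g ∘ proj₁) (cartesianProduct xs ys)
      ≡⟨ cong₂ ℤ._+_ (trans (∑-map (g ∘ proj₁) (x ,_) ys) (∑-const (g x) ys)) (∑-cartesianProduct g xs ys) ⟩
    + length ys ℤ.* g x ℤ.+ + length ys ℤ.* ∑ g xs                           ≡⟨ ℤ.*-distribˡ-+ (+ length ys) (g x) (∑ g xs) ⟨
    + length ys ℤ.* (g x ℤ.+ ∑ g xs)                                          ∎
    where open ≡-Reasoning

length-cartesianProductWith : ∀ {A B C : Set} (f : A → B → C) xs ys →
                              length (cartesianProductWith f xs ys) ≡ length xs ℕ.* length ys
length-cartesianProductWith f [] ys = refl
length-cartesianProductWith f (x ∷ xs) ys = trans (List.length-++ (map (f x) ys))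
  (cong₂ ℕ._+_ (List.length-map (f x) ys) (length-cartesianProductWith f xs ys))

module _ (s : ℤ) (s²≡1 : s ℤ.* s ≡ + 1) where
  private
    ^-2* : ∀ m → s ℤ.^ (m ℕ.* 2) ≡ + 1
    ^-2* ℕ.zero = refl
    ^-2* (ℕ.suc m) = trans (sym (ℤ.*-assoc s s (s ℤ.^ (m ℕ.* 2)))) (cong₂ ℤ._*_ s²≡1 (^-2* m))

  ^-even : ∀ k → k ℕ.% 2 ≡ 0 → s ℤ.^ k ≡ + 1
  ^-even k k-even = trans (cong (s ℤ.^_) (trans (m≡m%n+[m/n]*n k 2) (cong (ℕ._+ (k ℕ./ 2) ℕ.* 2) k-even))) (^-2* (k ℕ./ 2))

  ^-odd : ∀ k → k ℕ.% 2 ≡ 1 → s ℤ.^ k ≡ s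
  ^-odd k k-odd = trans (cong (s ℤ.^_) (trans (m≡m%n+[m/n]*n k 2) (cong (ℕ._+ (k ℕ./ 2) ℕ.* 2) k-odd)))
    (trans (cong (s ℤ.*_) (^-2* (k ℕ./ 2))) (ℤ.*-identityʳ s))

module PolynomialRing (F : FiniteField) where
  open FiniteField F public renaming (_+_ to infixl 6 _+F_; _*_ to infixl 7 _*F_; -_ to infix 8 -F_)
  open IsCommutativeRing isCommutativeRing public using ()
    renaming (+-assoc to +F-assoc; +-comm to +F-comm; +-identityˡ to +F-identityˡ; +-identityʳ to +F-identityʳ;
              -‿inverseˡ to -F‿inverseˡ; -‿inverseʳ to -F‿inverseʳ;
              *-assoc to *F-assoc; *-comm to *F-comm; *-identityˡ to *F-identityˡ;
              distribˡ to *F-distribˡ-+F; distribʳ to *F-distribʳ-+F; zeroˡ to *F-zeroˡ; zeroʳ to *F-zeroʳ)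
  open Poly F public

  -F0≡0 : -F 0# ≡ 0#
  -F0≡0 = trans (sym (+F-identityʳ (-F 0#))) (-F‿inverseˡ 0#)

  infixl 6 _⊕_ _⊖_
  infixl 7 _⊗_
  infix 8 ⊝_
  infix 4 _≋_

  -- Unnormalised versions of Poly's operations: their laws are proved coefficientwise, and strip-≋
  -- relates them to the normalising _+P_, _*P_, _-P_.
  _⊕_ _⊗_ _⊖_ : Pol → Pol → Pol
  _⊕_ = addL
  _⊗_ = mulL

  ⊝_ : Pol → Pol
  ⊝ f = map -F_ f

  f ⊖ g = f ⊕ ⊝ g

  scale : Carrier → Pol → Pol
  scale c f = map (c *F_) f

  coeff : Pol → ℕ → Carrier
  coeff [] n = 0#
  coeff (x ∷ f) zero = x
  coeff (x ∷ f) (suc n) = coeff f n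

  record _≋_ (f g : Pol) : Set where
    constructor mk≋
    field at : ∀ n → coeff f n ≡ coeff g n
  open _≋_ public

  ≋-refl : ∀ {f} → f ≋ f
  ≋-refl = mk≋ λ n → refl

  ≋-reflexive : ∀ {f g} → f ≡ g → f ≋ g
  ≋-reflexive refl = ≋-refl

  ≋-sym : ∀ {f g} → f ≋ g → g ≋ f
  ≋-sym p = mk≋ λ n → sym (at p n)

  ≋-trans : ∀ {f g h} → f ≋ g → g ≋ h → f ≋ h
  ≋-trans p q = mk≋ λ n → trans (at p n) (at q n)

  ∷-cong : ∀ {x y f g} → x ≡ y → f ≋ g → (x ∷ f) ≋ (y ∷ g)
  ∷-cong p q = mk≋ λ { zero → p ; (suc n) → at q n }

  ∷-injectiveˡ : ∀ {x y f g} → (x ∷ f) ≋ (y ∷ g) → x ≡ y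
  ∷-injectiveˡ p = at p zero

  ∷-injectiveʳ : ∀ {x y f g} → (x ∷ f) ≋ (y ∷ g) → f ≋ g
  ∷-injectiveʳ p = mk≋ λ n → at p (suc n)

  0∷[]≋[] : (0# ∷ []) ≋ []
  0∷[]≋[] = mk≋ λ { zero → refl ; (suc n) → refl }

  coeff-⊕ : ∀ f g n → coeff (f ⊕ g) n ≡ coeff f n +F coeff g n
  coeff-⊕ [] g n = sym (+F-identityˡ _)
  coeff-⊕ (x ∷ f) [] n = sym (+F-identityʳ _)
  coeff-⊕ (x ∷ f) (y ∷ g) zero = refl
  coeff-⊕ (x ∷ f) (y ∷ g) (suc n) = coeff-⊕ f g n

  coeff-scale : ∀ c f n → coeff (scale c f) n ≡ c *F coeff f n
  coeff-scale c [] n = sym (*F-zeroʳ c)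
  coeff-scale c (x ∷ f) zero = refl
  coeff-scale c (x ∷ f) (suc n) = coeff-scale c f n

  coeff-⊝ : ∀ f n → coeff (⊝ f) n ≡ -F coeff f n
  coeff-⊝ [] n = sym -F0≡0
  coeff-⊝ (x ∷ f) zero = refl
  coeff-⊝ (x ∷ f) (suc n) = coeff-⊝ f n

  stripCons : Carrier → Pol → Pol
  stripCons x (y ∷ ys) = x ∷ y ∷ ys
  stripCons x [] with x ≟ 0#
  ... | yes _ = []
  ... | no _ = x ∷ []

  strip-∷ : ∀ x xs → strip (x ∷ xs) ≡ stripCons x (strip xs)
  strip-∷ x xs with strip xs
  ... | y ∷ ys = refl
  ... | [] with x ≟ 0#
  ...   | yes _ = refl
  ...   | no _ = refl

  coeff-stripCons : ∀ x s n → coeff (stripCons x s) n ≡ coeff (x ∷ s) n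
  coeff-stripCons x (y ∷ ys) n = refl
  coeff-stripCons x [] n with x ≟ 0#
  coeff-stripCons x [] zero | yes x≡0 = sym x≡0
  coeff-stripCons x [] (suc n) | yes _ = refl
  coeff-stripCons x [] n | no _ = refl

  strip-≋ : ∀ f → strip f ≋ f
  strip-≋ [] = ≋-refl
  strip-≋ (x ∷ xs) rewrite strip-∷ x xs =
    ≋-trans (mk≋ (coeff-stripCons x (strip xs))) (∷-cong refl (strip-≋ xs))

  ≋[]⇒strip≡[] : ∀ f → f ≋ [] → strip f ≡ []
  ≋[]⇒strip≡[] [] p = refl
  ≋[]⇒strip≡[] (x ∷ f) p rewrite strip-∷ x f | ≋[]⇒strip≡[] f (mk≋ λ n → at p (suc n)) with x ≟ 0#
  ... | yes _ = refl
  ... | no x≢0 = ⊥-elim (x≢0 (at p zero))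

  ≋⇒≈P : ∀ {f g} → f ≋ g → f ≈P g
  ≋⇒≈P {[]} {g} p = sym (≋[]⇒strip≡[] g (≋-sym p))
  ≋⇒≈P {x ∷ f} {[]} p = ≋[]⇒strip≡[] (x ∷ f) p
  ≋⇒≈P {x ∷ f} {y ∷ g} p
    rewrite strip-∷ x f | strip-∷ y g | ∷-injectiveˡ p | ≋⇒≈P {f} {g} (∷-injectiveʳ p) = refl

  ≈P⇒≋ : ∀ {f g} → f ≈P g → f ≋ g
  ≈P⇒≋ {f} {g} e = ≋-trans (≋-sym (strip-≋ f)) (≋-trans (≋-reflexive e) (strip-≋ g))

  strip-idem : ∀ f → strip (strip f) ≡ strip f
  strip-idem f = ≋⇒≈P (strip-≋ f)

  ⊕-cong : ∀ {f f' g g'} → f ≋ f' → g ≋ g' → f ⊕ g ≋ f' ⊕ g'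
  ⊕-cong {f} {f'} {g} {g'} p q = mk≋ λ n →
    trans (coeff-⊕ f g n) (trans (cong₂ _+F_ (at p n) (at q n)) (sym (coeff-⊕ f' g' n)))

  ⊕-comm : ∀ f g → f ⊕ g ≋ g ⊕ f
  ⊕-comm f g = mk≋ λ n → trans (coeff-⊕ f g n) (trans (+F-comm _ _) (sym (coeff-⊕ g f n)))

  ⊕-assoc : ∀ f g h → f ⊕ g ⊕ h ≋ f ⊕ (g ⊕ h)
  ⊕-assoc f g h = mk≋ λ n → begin
    coeff (f ⊕ g ⊕ h) n                   ≡⟨ coeff-⊕ (f ⊕ g) h n ⟩
    coeff (f ⊕ g) n +F coeff h n          ≡⟨ cong (_+F coeff h n) (coeff-⊕ f g n) ⟩
    coeff f n +F coeff g n +F coeff h n   ≡⟨ +F-assoc _ _ _ ⟩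
    coeff f n +F (coeff g n +F coeff h n) ≡⟨ cong (coeff f n +F_) (coeff-⊕ g h n) ⟨
    coeff f n +F coeff (g ⊕ h) n          ≡⟨ coeff-⊕ f (g ⊕ h) n ⟨
    coeff (f ⊕ (g ⊕ h)) n                 ∎
    where open ≡-Reasoning

  ⊕-identityʳ : ∀ f → f ⊕ [] ≋ f
  ⊕-identityʳ f = mk≋ λ n → trans (coeff-⊕ f [] n) (+F-identityʳ _)

  ⊕-inverseʳ : ∀ f → f ⊖ f ≋ []
  ⊕-inverseʳ f = mk≋ λ n →
    trans (coeff-⊕ f (⊝ f) n) (trans (cong (coeff f n +F_) (coeff-⊝ f n)) (-F‿inverseʳ _))

  ⊕-swap : ∀ f g h → f ⊕ (g ⊕ h) ≋ g ⊕ (f ⊕ h)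
  ⊕-swap f g h = ≋-trans (≋-sym (⊕-assoc f g h)) (≋-trans (⊕-cong (⊕-comm f g) ≋-refl) (⊕-assoc g f h))

  ⊕-interchange : ∀ f g h k → (f ⊕ g) ⊕ (h ⊕ k) ≋ (f ⊕ h) ⊕ (g ⊕ k)
  ⊕-interchange f g h k =
    ≋-trans (⊕-assoc f g (h ⊕ k)) (≋-trans (⊕-cong (≋-refl {f}) (⊕-swap g h k)) (≋-sym (⊕-assoc f h (g ⊕ k))))

  ⊝-cong : ∀ {f g} → f ≋ g → ⊝ f ≋ ⊝ g
  ⊝-cong {f} {g} p = mk≋ λ n → trans (coeff-⊝ f n) (trans (cong -F_ (at p n)) (sym (coeff-⊝ g n)))

  scale-cong : ∀ c {f g} → f ≋ g → scale c f ≋ scale c g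
  scale-cong c {f} {g} p = mk≋ λ n →
    trans (coeff-scale c f n) (trans (cong (c *F_) (at p n)) (sym (coeff-scale c g n)))

  scale-distrib-⊕ : ∀ c f g → scale c (f ⊕ g) ≋ scale c f ⊕ scale c g
  scale-distrib-⊕ c f g = mk≋ λ n → begin
    coeff (scale c (f ⊕ g)) n                       ≡⟨ coeff-scale c (f ⊕ g) n ⟩
    c *F coeff (f ⊕ g) n                            ≡⟨ cong (c *F_) (coeff-⊕ f g n) ⟩
    c *F (coeff f n +F coeff g n)                   ≡⟨ *F-distribˡ-+F _ _ _ ⟩
    c *F coeff f n +F c *F coeff g n                ≡⟨ cong₂ _+F_ (coeff-scale c f n) (coeff-scale c g n) ⟨
    coeff (scale c f) n +F coeff (scale c g) n      ≡⟨ coeff-⊕ (scale c f) (scale c g) n ⟨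
    coeff (scale c f ⊕ scale c g) n                 ∎
    where open ≡-Reasoning

  scale-distrib-+F : ∀ c d f → scale (c +F d) f ≋ scale c f ⊕ scale d f
  scale-distrib-+F c d f = mk≋ λ n → begin
    coeff (scale (c +F d) f) n                      ≡⟨ coeff-scale (c +F d) f n ⟩
    (c +F d) *F coeff f n                           ≡⟨ *F-distribʳ-+F _ _ _ ⟩
    c *F coeff f n +F d *F coeff f n                ≡⟨ cong₂ _+F_ (coeff-scale c f n) (coeff-scale d f n) ⟨
    coeff (scale c f) n +F coeff (scale d f) n      ≡⟨ coeff-⊕ (scale c f) (scale d f) n ⟨
    coeff (scale c f ⊕ scale d f) n                 ∎
    where open ≡-Reasoning

  scale-scale : ∀ c d f → scale c (scale d f) ≋ scale (c *F d) f
  scale-scale c d f = mk≋ λ n → trans (coeff-scale c (scale d f) n)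
    (trans (cong (c *F_) (coeff-scale d f n)) (trans (sym (*F-assoc _ _ _)) (sym (coeff-scale (c *F d) f n))))

  scale-1# : ∀ f → scale 1# f ≋ f
  scale-1# f = mk≋ λ n → trans (coeff-scale 1# f n) (*F-identityˡ _)

  scale-0# : ∀ {c} f → c ≡ 0# → scale c f ≋ []
  scale-0# {c} f c≡0 = mk≋ λ n → trans (coeff-scale c f n) (trans (cong (_*F coeff f n) c≡0) (*F-zeroˡ _))

  ⊗-zeroʳ : ∀ f → f ⊗ [] ≋ []
  ⊗-zeroʳ [] = ≋-refl
  ⊗-zeroʳ (x ∷ f) = ≋-trans (∷-cong refl (⊗-zeroʳ f)) 0∷[]≋[]

  ⊗-congʳ : ∀ f {g g'} → g ≋ g' → f ⊗ g ≋ f ⊗ g'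
  ⊗-congʳ [] p = ≋-refl
  ⊗-congʳ (x ∷ f) p = ⊕-cong (scale-cong x p) (∷-cong refl (⊗-congʳ f p))

  ⊗-zeroˡ : ∀ {f} → f ≋ [] → ∀ g → f ⊗ g ≋ []
  ⊗-zeroˡ {[]} p g = ≋-refl
  ⊗-zeroˡ {x ∷ f} p g =
    ≋-trans (⊕-cong (scale-0# g (at p zero)) (∷-cong refl (⊗-zeroˡ {f} (mk≋ λ n → at p (suc n)) g))) 0∷[]≋[]

  ⊗-congˡ : ∀ {f f'} → f ≋ f' → ∀ g → f ⊗ g ≋ f' ⊗ g
  ⊗-congˡ {[]} {[]} p g = ≋-refl
  ⊗-congˡ {[]} {x' ∷ f'} p g = ≋-sym (⊗-zeroˡ (≋-sym p) g)
  ⊗-congˡ {x ∷ f} {[]} p g = ⊗-zeroˡ p g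
  ⊗-congˡ {x ∷ f} {x' ∷ f'} p g =
    ⊕-cong (≋-reflexive (cong (λ c → scale c g) (∷-injectiveˡ p))) (∷-cong refl (⊗-congˡ (∷-injectiveʳ p) g))

  ⊗-cong : ∀ {f f' g g'} → f ≋ f' → g ≋ g' → f ⊗ g ≋ f' ⊗ g'
  ⊗-cong {f} {f'} {g} {g'} p q = ≋-trans (⊗-congˡ p g) (⊗-congʳ f' q)

  ⊗-∷ʳ : ∀ g x f → g ⊗ (x ∷ f) ≋ scale x g ⊕ (0# ∷ g ⊗ f)
  ⊗-∷ʳ [] x f = ≋-sym 0∷[]≋[]
  ⊗-∷ʳ (y ∷ g) x f =
    ∷-cong (cong (_+F 0#) (*F-comm y x))
      (≋-trans (⊕-cong (≋-refl {scale y f}) (⊗-∷ʳ g x f)) (⊕-swap (scale y f) (scale x g) (0# ∷ g ⊗ f)))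

  ⊗-comm : ∀ f g → f ⊗ g ≋ g ⊗ f
  ⊗-comm [] g = ≋-sym (⊗-zeroʳ g)
  ⊗-comm (x ∷ f) g = ≋-trans (⊕-cong (≋-refl {scale x g}) (∷-cong refl (⊗-comm f g))) (≋-sym (⊗-∷ʳ g x f))

  scale-⊗ : ∀ c f g → scale c f ⊗ g ≋ scale c (f ⊗ g)
  scale-⊗ c [] g = ≋-refl
  scale-⊗ c (x ∷ f) g =
    ≋-trans (⊕-cong (≋-sym (scale-scale c x g)) (∷-cong (sym (*F-zeroʳ c)) (scale-⊗ c f g)))
            (≋-sym (scale-distrib-⊕ c (scale x g) (0# ∷ f ⊗ g)))

  ⊗-distribʳ : ∀ h f g → (f ⊕ g) ⊗ h ≋ f ⊗ h ⊕ g ⊗ h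
  ⊗-distribʳ h [] g = ≋-refl
  ⊗-distribʳ h (x ∷ f) [] = ≋-sym (⊕-identityʳ _)
  ⊗-distribʳ h (x ∷ f) (y ∷ g) =
    ≋-trans (⊕-cong (scale-distrib-+F x y h) (∷-cong (sym (+F-identityˡ 0#)) (⊗-distribʳ h f g)))
            (⊕-interchange (scale x h) (scale y h) (0# ∷ f ⊗ h) (0# ∷ g ⊗ h))

  ⊗-assoc : ∀ f g h → f ⊗ g ⊗ h ≋ f ⊗ (g ⊗ h)
  ⊗-assoc [] g h = ≋-refl
  ⊗-assoc (x ∷ f) g h =
    ≋-trans (⊗-distribʳ h (scale x g) (0# ∷ f ⊗ g))
      (⊕-cong (scale-⊗ x g h) (≋-trans (⊕-cong (scale-0# h refl) ≋-refl) (∷-cong refl (⊗-assoc f g h))))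

  [c]⊗≋scale : ∀ c g → (c ∷ []) ⊗ g ≋ scale c g
  [c]⊗≋scale c g = ≋-trans (⊕-cong (≋-refl {scale c g}) 0∷[]≋[]) (⊕-identityʳ _)

  ⊗-identityˡ : ∀ f → oneP ⊗ f ≋ f
  ⊗-identityˡ f = ≋-trans ([c]⊗≋scale 1# f) (scale-1# f)

  ⊗-distribˡ : ∀ f g h → f ⊗ (g ⊕ h) ≋ f ⊗ g ⊕ f ⊗ h
  ⊗-distribˡ f g h =
    ≋-trans (⊗-comm f (g ⊕ h)) (≋-trans (⊗-distribʳ f g h) (⊕-cong (⊗-comm g f) (⊗-comm h f)))

  polynomialRing : CommutativeRing _ _
  polynomialRing = record
    { Carrier = Pol ; _≈_ = _≋_ ; _+_ = _⊕_ ; _*_ = _⊗_ ; -_ = ⊝_ ; 0# = [] ; 1# = oneP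
    ; isCommutativeRing = record
      { isRing = record
        { +-isAbelianGroup = record
          { isGroup = record
            { isMonoid = record
              { isSemigroup = record
                { isMagma = record
                  { isEquivalence = record { refl = ≋-refl ; sym = ≋-sym ; trans = ≋-trans }
                  ; ∙-cong = ⊕-cong }
                ; assoc = ⊕-assoc }
              ; identity = (λ f → ≋-refl) , ⊕-identityʳ }
            ; inverse = (λ f → ≋-trans (⊕-comm (⊝ f) f) (⊕-inverseʳ f)) , ⊕-inverseʳ
            ; ⁻¹-cong = ⊝-cong }
          ; comm = ⊕-comm }
        ; *-cong = ⊗-cong
        ; *-assoc = ⊗-assoc
        ; *-identity = ⊗-identityˡ , (λ f → ≋-trans (⊗-comm f oneP) (⊗-identityˡ f))
        ; distrib = ⊗-distribˡ , ⊗-distribʳ }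
      ; *-comm = ⊗-comm } }

  module PolynomialSolver = ℤ-RingSolver polynomialRing

module PolynomialDivision (F : FiniteField) where
  open PolynomialRing F public

  Deg< : Pol → ℕ → Set
  Deg< f n = ∀ i → n ≤ i → coeff f i ≡ 0#

  deg<-mono : ∀ {f m n} → Deg< f m → m ≤ n → Deg< f n
  deg<-mono b m≤n i n≤i = b i (ℕ.≤-trans m≤n n≤i)

  deg<-cong : ∀ {f g n} → f ≋ g → Deg< f n → Deg< g n
  deg<-cong p b i n≤i = trans (sym (at p i)) (b i n≤i)

  deg<-⊕ : ∀ {f g n} → Deg< f n → Deg< g n → Deg< (f ⊕ g) n
  deg<-⊕ {f} {g} bf bg i n≤i = trans (coeff-⊕ f g i) (trans (cong₂ _+F_ (bf i n≤i) (bg i n≤i)) (+F-identityˡ 0#))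

  deg<-⊝ : ∀ {f n} → Deg< f n → Deg< (⊝ f) n
  deg<-⊝ {f} b i n≤i = trans (coeff-⊝ f i) (trans (cong -F_ (b i n≤i)) -F0≡0)

  deg<-length : ∀ f → Deg< f (length f)
  deg<-length [] i _ = refl
  deg<-length (x ∷ f) (suc i) (s≤s n≤i) = deg<-length f i n≤i

  deg<-[] : ∀ n → Deg< [] n
  deg<-[] n i _ = refl

  deg<0⇒≋[] : ∀ {f} → Deg< f 0 → f ≋ []
  deg<0⇒≋[] b = mk≋ λ n → b n z≤n

  HasDegree : Pol → ℕ → Set
  HasDegree f e = (coeff f e ≢ 0#) × Deg< f (suc e)

  MonicOfDegree : Pol → ℕ → Set
  MonicOfDegree f e = HasDegree f e × coeff f e ≡ 1#

  hasDegree-cong : ∀ {f g e} → f ≋ g → HasDegree f e → HasDegree g e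
  hasDegree-cong p (c≢0 , b) = (λ c≡0 → c≢0 (trans (at p _) c≡0)) , deg<-cong p b

  hasDegree⇒< : ∀ {f e n} → HasDegree f e → Deg< f n → e < n
  hasDegree⇒< {e = e} {n} (c≢0 , _) b with n ℕ.≤? e
  ... | yes n≤e = ⊥-elim (c≢0 (b e n≤e))
  ... | no n≰e = ℕ.≰⇒> n≰e

  hasDegree⇒≉[] : ∀ {f e} → HasDegree f e → ¬ (f ≋ [])
  hasDegree⇒≉[] (c≢0 , _) f≋[] = c≢0 (at f≋[] _)

  ≋[]⊎hasDegree : ∀ f → (f ≋ []) ⊎ Σ ℕ (HasDegree f)
  ≋[]⊎hasDegree [] = inj₁ ≋-refl
  ≋[]⊎hasDegree (x ∷ f) with ≋[]⊎hasDegree f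
  ... | inj₂ (e , c≢0 , b) = inj₂ (suc e , c≢0 , λ { (suc i) (s≤s e<i) → b i e<i })
  ... | inj₁ f≋[] with x ≟ 0#
  ...   | yes x≡0 = inj₁ (≋-trans (∷-cong x≡0 f≋[]) 0∷[]≋[])
  ...   | no x≢0 = inj₂ (0 , x≢0 , λ { (suc i) _ → at f≋[] i })

  coeff-⊗-top : ∀ f g e m → Deg< f (suc e) → Deg< g (suc m) →
                (coeff (f ⊗ g) (e ℕ.+ m) ≡ coeff f e *F coeff g m) × Deg< (f ⊗ g) (suc (e ℕ.+ m))
  coeff-⊗-top [] g e m bf bg = sym (*F-zeroˡ _) , deg<-[] _
  coeff-⊗-top (x ∷ f) g zero m bf bg = trans (at x∷f⊗g≋xg m) (coeff-scale x g m) , b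
    where
    x∷f⊗g≋xg : (x ∷ f) ⊗ g ≋ scale x g
    x∷f⊗g≋xg = ≋-trans (⊕-cong (≋-refl {scale x g})
      (≋-trans (∷-cong refl (⊗-zeroˡ {f} (mk≋ λ n → bf (suc n) (s≤s z≤n)) g)) 0∷[]≋[])) (⊕-identityʳ _)
    b : Deg< ((x ∷ f) ⊗ g) (suc m)
    b i m<i = trans (at x∷f⊗g≋xg i) (trans (coeff-scale x g i) (trans (cong (x *F_) (bg i m<i)) (*F-zeroʳ x)))
  coeff-⊗-top (x ∷ f) g (suc e) m bf bg = top , b
    where
    ih = coeff-⊗-top f g e m (λ i le → bf (suc i) (s≤s le)) bg
    xg-vanishes : ∀ i → e ℕ.+ m ≤ i → coeff (scale x g) (suc i) ≡ 0#
    xg-vanishes i le = trans (coeff-scale x g (suc i))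
      (trans (cong (x *F_) (bg (suc i) (s≤s (ℕ.≤-trans (ℕ.m≤n+m m e) le)))) (*F-zeroʳ x))
    top : coeff ((x ∷ f) ⊗ g) (suc (e ℕ.+ m)) ≡ coeff f e *F coeff g m
    top = begin
      coeff ((x ∷ f) ⊗ g) (suc (e ℕ.+ m))                         ≡⟨ coeff-⊕ (scale x g) (0# ∷ f ⊗ g) _ ⟩
      coeff (scale x g) (suc (e ℕ.+ m)) +F coeff (f ⊗ g) (e ℕ.+ m) ≡⟨ cong₂ _+F_ (xg-vanishes _ ℕ.≤-refl) (proj₁ ih) ⟩
      0# +F coeff f e *F coeff g m                                ≡⟨ +F-identityˡ _ ⟩
      coeff f e *F coeff g m                                      ∎
      where open ≡-Reasoning
    b : Deg< ((x ∷ f) ⊗ g) (suc (suc (e ℕ.+ m)))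
    b (suc i) (s≤s le) = trans (coeff-⊕ (scale x g) (0# ∷ f ⊗ g) (suc i))
      (trans (cong₂ _+F_ (xg-vanishes i (ℕ.≤-trans (ℕ.n≤1+n _) le)) (proj₂ ih i le)) (+F-identityˡ 0#))

  monicOfDegree-⊗ : ∀ f g {e m} → MonicOfDegree f e → MonicOfDegree g m → MonicOfDegree (f ⊗ g) (e ℕ.+ m)
  monicOfDegree-⊗ f g {e} {m} ((_ , bf) , cf) ((_ , bg) , cg) = ((λ c≡0 → 0≢1 (trans (sym c≡0) c≡1)) , proj₂ top) , c≡1
    where
    top = coeff-⊗-top f g e m bf bg
    c≡1 = trans (proj₁ top) (trans (cong₂ _*F_ cf cg) (*F-identityˡ 1#))

  private
    coeff-length≡last : ∀ x f {c} → last (x ∷ f) ≡ just c → coeff (x ∷ f) (length f) ≡ c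
    coeff-length≡last x [] refl = refl
    coeff-length≡last x (y ∷ f) e = coeff-length≡last y f e

    strip-last : ∀ f {c} → last f ≡ just c → c ≢ 0# → strip f ≡ f
    strip-last (x ∷ []) refl c≢0 with x ≟ 0#
    ... | yes x≡0 = ⊥-elim (c≢0 x≡0)
    ... | no _ = refl
    strip-last (x ∷ y ∷ f) e c≢0 = trans (strip-∷ x (y ∷ f)) (cong (stripCons x) (strip-last (y ∷ f) e c≢0))

    strip-top : ∀ f e → HasDegree f e → (last (strip f) ≡ just (coeff f e)) × (length (strip f) ≡ suc e)
    strip-top [] e (c≢0 , _) = ⊥-elim (c≢0 refl)
    strip-top (x ∷ f) zero (c≢0 , b) rewrite strip-∷ x f | ≋[]⇒strip≡[] f (mk≋ λ n → b (suc n) (s≤s z≤n)) with x ≟ 0#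
    ... | yes x≡0 = ⊥-elim (c≢0 x≡0)
    ... | no _ = refl , refl
    strip-top (x ∷ f) (suc e) (c≢0 , b) rewrite strip-∷ x f
      with strip f | strip-top f e (c≢0 , λ i le → b (suc i) (s≤s le))
    ... | [] | (_ , ())
    ... | y ∷ ys | (l , len) = l , cong suc len

  monicOfDegree⇒Monic : ∀ f {e} → MonicOfDegree f e → Monic (strip f)
  monicOfDegree⇒Monic f {e} (t , c≡1) = trans (proj₁ (strip-top f e t)) (cong just c≡1)

  hasDegree⇒deg≡ : ∀ f {e} → HasDegree f e → deg f ≡ e
  hasDegree⇒deg≡ f {e} t = cong (_∸ 1) (proj₂ (strip-top f e t))

  monic⇒monicOfDegree : ∀ f → Monic f → MonicOfDegree f (deg f)
  monic⇒monicOfDegree [] ()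
  monic⇒monicOfDegree (x ∷ f) mf rewrite strip-last (x ∷ f) mf (λ 1≡0 → 0≢1 (sym 1≡0)) =
    ((λ c≡0 → 0≢1 (trans (sym c≡0) c≡1)) , deg<-length (x ∷ f)) , c≡1
    where c≡1 = coeff-length≡last x f mf

  record _∣_ (f g : Pol) : Set where
    constructor divides
    field quotient : Pol
          equation : f ⊗ quotient ≋ g

  ∣-respʳ : ∀ {f g g'} → g ≋ g' → f ∣ g → f ∣ g'
  ∣-respʳ p (divides h q) = divides h (≋-trans q p)

  ∣-respˡ : ∀ {f f' g} → f ≋ f' → f ∣ g → f' ∣ g
  ∣-respˡ p (divides h q) = divides h (≋-trans (⊗-congˡ (≋-sym p) h) q)

  ∣-⊕ : ∀ {f g g'} → f ∣ g → f ∣ g' → f ∣ (g ⊕ g')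
  ∣-⊕ {f} (divides h p) (divides h' p') = divides (h ⊕ h') (≋-trans (⊗-distribˡ f h h') (⊕-cong p p'))

  ∣-⊗ʳ : ∀ {f g} → f ∣ g → ∀ k → f ∣ (g ⊗ k)
  ∣-⊗ʳ {f} (divides h p) k = divides (h ⊗ k) (≋-trans (≋-sym (⊗-assoc f h k)) (⊗-congˡ p k))

  ∣-⊗ˡ : ∀ {f g} → f ∣ g → ∀ k → f ∣ (k ⊗ g)
  ∣-⊗ˡ {f} {g} d k = ∣-respʳ (⊗-comm g k) (∣-⊗ʳ d k)

  ∣-⊝ : ∀ {f g} → f ∣ g → f ∣ (⊝ g)
  ∣-⊝ {f} {g} d = ∣-respʳ (solve 1 (λ g → g :* (:- con (ℤ.+ 1)) := :- g) ≋-refl g) (∣-⊗ʳ d (⊝ oneP))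
    where open PolynomialSolver

  ∣-⊖ : ∀ {f g h} → f ∣ g → f ∣ h → f ∣ (g ⊖ h)
  ∣-⊖ dg dh = ∣-⊕ dg (∣-⊝ dh)

  ∣-refl : ∀ f → f ∣ f
  ∣-refl f = divides oneP (≋-trans (⊗-comm f oneP) (⊗-identityˡ f))

  ∣-[] : ∀ f → f ∣ []
  ∣-[] f = divides [] (⊗-zeroʳ f)

  f∣f⊗g : ∀ f g → f ∣ (f ⊗ g)
  f∣f⊗g f g = divides g ≋-refl

  ∣-trans : ∀ {f g h} → f ∣ g → g ∣ h → f ∣ h
  ∣-trans d (divides k q) = ∣-respʳ q (∣-⊗ʳ d k)

  *P-≋ : ∀ f g → (f *P g) ≋ f ⊗ g
  *P-≋ f g = strip-≋ (f ⊗ g)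

  -P-≋ : ∀ f g → (f -P g) ≋ f ⊖ g
  -P-≋ f g = ≋-trans (strip-≋ (f ⊕ negP g)) (⊕-cong (≋-refl {f}) (strip-≋ (⊝ g)))

  pow : Pol → ℕ → Pol
  pow f zero = oneP
  pow f (suc k) = f ⊗ pow f k

  ^P-≋ : ∀ f k → (f ^P k) ≋ pow f k
  ^P-≋ f zero = ≋-refl
  ^P-≋ f (suc k) = ≋-trans (*P-≋ f (f ^P k)) (⊗-congʳ f (^P-≋ f k))

  ∣P⇒∣ : ∀ {f g} → f ∣P g → f ∣ g
  ∣P⇒∣ {f} (h , e) = divides h (≋-trans (≋-sym (*P-≋ f h)) (≈P⇒≋ e))

  ∣⇒∣P : ∀ {f g} → f ∣ g → f ∣P g
  ∣⇒∣P {f} (divides h p) = h , ≋⇒≈P (≋-trans (*P-≋ f h) p)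

  monomial : Carrier → ℕ → Pol
  monomial c zero = c ∷ []
  monomial c (suc j) = 0# ∷ monomial c j

  coeff-monomial : ∀ c j → coeff (monomial c j) j ≡ c
  coeff-monomial c zero = refl
  coeff-monomial c (suc j) = coeff-monomial c j

  deg<-monomial : ∀ c j → Deg< (monomial c j) (suc j)
  deg<-monomial c zero (suc i) _ = refl
  deg<-monomial c (suc j) (suc i) (s≤s le) = deg<-monomial c j i le

  module DivisionByMonic (m : Pol) (d : ℕ) (m-monic : MonicOfDegree m d) where
    open PolynomialSolver

    private
      m-deg< : Deg< m (suc d)
      m-deg< = proj₂ (proj₁ m-monic)

    DivMod : Pol → Set
    DivMod f = Σ Pol λ q → Σ Pol λ r → (f ≋ m ⊗ q ⊕ r) × Deg< r d

    -- Long division: each step cancels the leading coefficient c at position n with c·T^(n-d)·m.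
    divModBelow : ∀ n f → Deg< f n → DivMod f
    divModBelow n f b with n ℕ.≤? d
    ... | yes n≤d = [] , f , ⊕-cong (≋-sym (⊗-zeroʳ m)) (≋-refl {f}) , deg<-mono {f} b n≤d
    divModBelow zero f b | no 0≰d = ⊥-elim (0≰d z≤n)
    divModBelow (suc n) f b | no n≰d = quo ⊕ t , r , f≋ , r-deg<
      where
      d≤n : d ≤ n
      d≤n = ℕ.≤-pred (ℕ.≰⇒> n≰d)
      d+j≡n : d ℕ.+ (n ∸ d) ≡ n
      d+j≡n = ℕ.m+[n∸m]≡n d≤n
      c = coeff f n
      t = monomial c (n ∸ d)
      top = coeff-⊗-top m t d (n ∸ d) m-deg< (deg<-monomial c (n ∸ d))
      coeff-mt : coeff (m ⊗ t) n ≡ c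
      coeff-mt = trans (cong (coeff (m ⊗ t)) (sym d+j≡n))
        (trans (proj₁ top) (trans (cong₂ _*F_ (proj₂ m-monic) (coeff-monomial c (n ∸ d))) (*F-identityˡ c)))
      f-mt<n : Deg< (f ⊖ m ⊗ t) n
      f-mt<n i n≤i with ℕ.m≤n⇒m<n∨m≡n n≤i
      ... | inj₁ n<i = deg<-⊕ {f} {⊝ (m ⊗ t)} b (deg<-⊝ {m ⊗ t} (subst (λ k → Deg< (m ⊗ t) (suc k)) d+j≡n (proj₂ top))) i n<i
      ... | inj₂ refl = trans (coeff-⊕ f (⊝ (m ⊗ t)) n)
        (trans (cong (c +F_) (trans (coeff-⊝ (m ⊗ t) n) (cong -F_ coeff-mt))) (-F‿inverseʳ c))
      rec = divModBelow n (f ⊖ m ⊗ t) f-mt<n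
      quo = proj₁ rec
      r = proj₁ (proj₂ rec)
      r-deg< = proj₂ (proj₂ (proj₂ rec))
      f≋ : f ≋ m ⊗ (quo ⊕ t) ⊕ r
      f≋ = ≋-trans (solve 2 (λ f g → f := (f :- g) :+ g) ≋-refl f (m ⊗ t))
        (≋-trans (⊕-cong (proj₁ (proj₂ (proj₂ rec))) (≋-refl {m ⊗ t}))
          (solve 4 (λ m q r t → (m :* q :+ r) :+ m :* t := m :* (q :+ t) :+ r) ≋-refl m quo r t))

    divMod : ∀ f → DivMod f
    divMod f = divModBelow (length f) f (deg<-length f)

    multiple-deg<⇒≋[] : ∀ {h r} → m ⊗ h ≋ r → Deg< r d → h ≋ []
    multiple-deg<⇒≋[] {h} {r} p b with ≋[]⊎hasDegree h
    ... | inj₁ h≋[] = h≋[]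
    ... | inj₂ (e , c≢0 , bh) = ⊥-elim (c≢0 (begin
        coeff h e                  ≡⟨ *F-identityˡ _ ⟨
        1# *F coeff h e            ≡⟨ cong (_*F coeff h e) (proj₂ m-monic) ⟨
        coeff m d *F coeff h e     ≡⟨ proj₁ (coeff-⊗-top m h d e m-deg< bh) ⟨
        coeff (m ⊗ h) (d ℕ.+ e)    ≡⟨ at p (d ℕ.+ e) ⟩
        coeff r (d ℕ.+ e)          ≡⟨ b (d ℕ.+ e) (ℕ.m≤m+n d e) ⟩
        0#                         ∎))
      where open ≡-Reasoning

    remainder-unique : ∀ r r' → Deg< r d → Deg< r' d → m ∣ (r ⊖ r') → r ≋ r'
    remainder-unique r r' b b' (divides h p) =
      ≋-trans (solve 2 (λ r s → r := (r :- s) :+ s) ≋-refl r r') (≋-trans (⊕-cong r-r'≋[] (≋-refl {r'})) ≋-refl)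
      where
      h≋[] = multiple-deg<⇒≋[] p (deg<-⊕ {r} {⊝ r'} b (deg<-⊝ {r'} b'))
      r-r'≋[] : r ⊖ r' ≋ []
      r-r'≋[] = ≋-trans (≋-sym p) (≋-trans (⊗-congʳ m h≋[]) (⊗-zeroʳ m))

    rem : Pol → Pol
    rem f = proj₁ (proj₂ (divMod f))

    rem-deg< : ∀ f → Deg< (rem f) d
    rem-deg< f = proj₂ (proj₂ (proj₂ (divMod f)))

    ∣-⊖rem : ∀ f → m ∣ (f ⊖ rem f)
    ∣-⊖rem f with divMod f
    ... | quo , r , f≋ , _ = divides quo (≋-sym (≋-trans (⊕-cong f≋ (≋-refl {⊝ r}))
      (solve 3 (λ m q r → m :* q :+ r :- r := m :* q) ≋-refl m quo r)))

    ∣? : ∀ f → Dec (m ∣ f)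
    ∣? f with ≋[]⊎hasDegree (rem f)
    ... | inj₁ r≋[] = yes (∣-respʳ (≋-trans (⊕-cong (≋-refl {f}) (⊝-cong r≋[])) (⊕-identityʳ f)) (∣-⊖rem f))
    ... | inj₂ (e , t) = no λ m∣f → hasDegree⇒≉[] t (remainder-unique (rem f) [] (rem-deg< f) (deg<-[] d)
          (∣-respʳ (solve 2 (λ f r → f :- (f :- r) := r :- con (ℤ.+ 0)) ≋-refl f (rem f)) (∣-⊖ m∣f (∣-⊖rem f))))

module ResidueEnumeration (F : FiniteField) where
  open PolynomialDivision F public

  Polys< : ℕ → List Pol
  Polys< n = map strip (allLists n)

  private
    allLists-suc : ∀ n → allLists (suc n) ≡ cartesianProductWith _∷_ elements (allLists n)
    allLists-suc n = go elements
      where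
      go : ∀ xs → concatMap (λ x → map (x ∷_) (allLists n)) xs ≡ cartesianProductWith _∷_ xs (allLists n)
      go [] = refl
      go (x ∷ xs) = cong (map (x ∷_) (allLists n) ++_) (go xs)

    length-allLists : ∀ n → length (allLists n) ≡ q ^ n
    length-allLists zero = refl
    length-allLists (suc n) rewrite allLists-suc n =
      trans (length-cartesianProductWith _∷_ elements (allLists n)) (cong (q ℕ.*_) (length-allLists n))

    ∈-allLists⇒length : ∀ n {f} → f ∈ allLists n → length f ≡ n
    ∈-allLists⇒length zero (here refl) = refl
    ∈-allLists⇒length (suc n) f∈ rewrite allLists-suc n with ∈.∈-cartesianProductWith⁻ _∷_ elements (allLists n) f∈
    ... | x , g , _ , g∈ , refl = cong suc (∈-allLists⇒length n g∈)

    unique-allLists : ∀ n → Unique (allLists n)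
    unique-allLists zero = [] ∷ []
    unique-allLists (suc n) rewrite allLists-suc n =
      Unique.cartesianProductWith⁺ _∷_ List.∷-injective unique (unique-allLists n)

    pad : ℕ → Pol → Pol
    pad zero f = []
    pad (suc n) [] = 0# ∷ pad n []
    pad (suc n) (x ∷ f) = x ∷ pad n f

    pad-∈ : ∀ n f → pad n f ∈ allLists n
    pad-∈ zero f = here refl
    pad-∈ (suc n) [] rewrite allLists-suc n = ∈.∈-cartesianProductWith⁺ _∷_ (complete 0#) (pad-∈ n [])
    pad-∈ (suc n) (x ∷ f) rewrite allLists-suc n = ∈.∈-cartesianProductWith⁺ _∷_ (complete x) (pad-∈ n f)

    pad-≋ : ∀ n f → Deg< f n → pad n f ≋ f
    pad-≋ zero f b = ≋-sym (deg<0⇒≋[] {f} b)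
    pad-≋ (suc n) [] b = ≋-trans (∷-cong refl (pad-≋ n [] (deg<-[] n))) 0∷[]≋[]
    pad-≋ (suc n) (x ∷ f) b = ∷-cong refl (pad-≋ n f (λ i le → b (suc i) (s≤s le)))

    ≋⇒≡-sameLength : ∀ f g → length f ≡ length g → f ≋ g → f ≡ g
    ≋⇒≡-sameLength [] [] _ _ = refl
    ≋⇒≡-sameLength (x ∷ f) (y ∷ g) e p = cong₂ _∷_ (∷-injectiveˡ p) (≋⇒≡-sameLength f g (ℕ.suc-injective e) (∷-injectiveʳ p))

  Stripped : Pol → Set
  Stripped f = strip f ≡ f

  ≋⇒≡-stripped : ∀ {f g} → Stripped f → Stripped g → f ≋ g → f ≡ g
  ≋⇒≡-stripped {f} {g} sf sg p = trans (sym sf) (trans (≋⇒≈P p) sg)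

  length-Polys< : ∀ n → length (Polys< n) ≡ q ^ n
  length-Polys< n = trans (List.length-map strip (allLists n)) (length-allLists n)

  Polys<-complete : ∀ n {f} → Stripped f → Deg< f n → f ∈ Polys< n
  Polys<-complete n {f} sf b = subst (_∈ Polys< n) (trans (≋⇒≈P (pad-≋ n f b)) sf) (∈.∈-map⁺ strip (pad-∈ n f))

  Polys<-sound : ∀ n {f} → f ∈ Polys< n → Stripped f × Deg< f n
  Polys<-sound n f∈ with ∈.∈-map⁻ strip f∈
  ... | g , g∈ , refl = strip-idem g , deg<-cong (≋-sym (strip-≋ g)) (subst (Deg< g) (∈-allLists⇒length n g∈) (deg<-length g))

  unique-Polys< : ∀ n → Unique (Polys< n)
  unique-Polys< n = unique-map strip (allLists n) (unique-allLists n)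
    (λ f∈ g∈ e → ≋⇒≡-sameLength _ _ (trans (∈-allLists⇒length n f∈) (sym (∈-allLists⇒length n g∈))) (≈P⇒≋ e))

  -- x ↦ x + 1 would be a fixed-point-free involution of the field, forcing q to be even
  1+1≢0 : q % 2 ≡ 1 → 1# +F 1# ≢ 0#
  1+1≢0 q-odd 1+1≡0 with evenLength q elements refl unique (λ {x} _ → complete (x +F 1#))
    where
    shift-involutive : ∀ x → x +F 1# +F 1# ≡ x
    shift-involutive x = trans (+F-assoc x 1# 1#) (trans (cong (x +F_) 1+1≡0) (+F-identityʳ x))

    shift-≢ : ∀ x → x +F 1# ≢ x
    shift-≢ x e = 0≢1 (sym (begin
      1#                  ≡⟨ +F-identityˡ 1# ⟨
      0# +F 1#            ≡⟨ cong (_+F 1#) (-F‿inverseˡ x) ⟨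
      -F x +F x +F 1#     ≡⟨ +F-assoc _ _ _ ⟩
      -F x +F (x +F 1#)   ≡⟨ cong (-F x +F_) e ⟩
      -F x +F x           ≡⟨ -F‿inverseˡ x ⟩
      0#                  ∎))
      where open ≡-Reasoning

    evenLength : ∀ n xs → length xs ≡ n → Unique xs → (∀ {x} → x ∈ xs → x +F 1# ∈ xs) → Σ ℕ λ m → n ≡ m ℕ.+ m
    evenLength zero [] refl _ _ = 0 , refl
    evenLength (suc zero) (x ∷ []) refl _ closed with closed (here refl)
    ... | here e = ⊥-elim (shift-≢ x e)
    evenLength (suc (suc n)) (x ∷ xs) len (x∉ ∷ u) closed =
      suc m , cong suc (trans (cong suc n≡m+m) (sym (ℕ.+-suc m m)))
      where
      x+1∈xs : x +F 1# ∈ xs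
      x+1∈xs with closed (here refl)
      ... | here e = ⊥-elim (shift-≢ x e)
      ... | there x+1∈ = x+1∈
      ys = xs ─ x+1∈xs
      ys-closed : ∀ {y} → y ∈ ys → y +F 1# ∈ ys
      ys-closed {y} y∈ys = ∈-─⁺ xs x+1∈xs y+1∈xs
                             (λ e → y≢x (trans (sym (shift-involutive y)) (trans (cong (_+F 1#) e) (shift-involutive x))))
        where
        y∈xs = ∈-─⁻ xs x+1∈xs y∈ys
        y≢x : y ≢ x
        y≢x refl = All≢⇒∉ x∉ y∈xs
        y+1∈xs : y +F 1# ∈ xs
        y+1∈xs with closed (there y∈xs)
        ... | here e = ⊥-elim (∉-─ xs x+1∈xs u (subst (_∈ ys) (trans (sym (shift-involutive y)) (cong (_+F 1#) e)) y∈ys))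
        ... | there y+1∈ = y+1∈
      rec = evenLength n ys (ℕ.suc-injective (ℕ.suc-injective (trans (cong suc (sym (length-─ xs x+1∈xs))) len)))
                       (unique-─ xs x+1∈xs u) ys-closed
      m = proj₁ rec
      n≡m+m = proj₂ rec
  ... | m , q≡m+m = ℕ.0≢1+n (trans (sym (m*n%n≡0 m 2)) (trans (cong (_% 2) 2m≡q) q-odd))
    where
    2m≡q : m ℕ.* 2 ≡ q
    2m≡q = trans (ℕ.*-comm m 2) (trans (cong (m ℕ.+_) (ℕ.+-identityʳ m)) (sym q≡m+m))

module MonicIrreducibleModulus (F : FiniteField) {ℓ : Poly.Pol F} (ℓ-irr : Poly.MonicIrreducible F ℓ) where
  open PolynomialDivision F public
  open PolynomialSolver

  d : ℕ
  d = deg ℓ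

  ℓ-monic : MonicOfDegree ℓ d
  ℓ-monic = monic⇒monicOfDegree ℓ (proj₁ ℓ-irr)

  open DivisionByMonic ℓ d ℓ-monic public

  ℓ≉oneP : ¬ (ℓ ≋ oneP)
  ℓ≉oneP ℓ≋1 = proj₁ (proj₂ ℓ-irr) (≋⇒≈P ℓ≋1)

  private
    ≋oneP : ∀ {f} → coeff f 0 ≡ 1# → Deg< f 1 → f ≋ oneP
    ≋oneP c b = mk≋ λ { zero → c ; (suc n) → b (suc n) (s≤s z≤n) }

  1≤d : 1 ≤ d
  1≤d with d | ℓ-monic
  ... | zero | ((_ , b) , c≡1) = ⊥-elim (ℓ≉oneP (≋oneP c≡1 b))
  ... | suc _ | _ = s≤s z≤n

  monic-∣oneP⇒≋oneP : ∀ {g} → Monic g → g ∣ oneP → g ≋ oneP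
  monic-∣oneP⇒≋oneP {g} g-monic (divides h gh≋1) with deg g | monic⇒monicOfDegree g g-monic
  ... | zero | ((_ , b) , c≡1) = ≋oneP c≡1 b
  ... | suc e | ((_ , bg) , c≡1) with ≋[]⊎hasDegree h
  ...   | inj₁ h≋[] = ⊥-elim (0≢1 (at (≋-trans (≋-sym (≋-trans (⊗-congʳ g h≋[]) (⊗-zeroʳ g))) gh≋1) 0))
  ...   | inj₂ (m , c≢0 , bh) = ⊥-elim (c≢0 (begin
      coeff h m                    ≡⟨ *F-identityˡ _ ⟨
      1# *F coeff h m              ≡⟨ cong (_*F coeff h m) c≡1 ⟨
      coeff g (suc e) *F coeff h m ≡⟨ proj₁ (coeff-⊗-top g h (suc e) m bg bh) ⟨
      coeff (g ⊗ h) (suc e ℕ.+ m)  ≡⟨ at gh≋1 _ ⟩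
      0#                           ∎))
    where open ≡-Reasoning

  ℓ∤oneP : ¬ ℓ ∣ oneP
  ℓ∤oneP ℓ∣1 = ℓ≉oneP (monic-∣oneP⇒≋oneP (proj₁ ℓ-irr) ℓ∣1)

  module Bezout (f : Pol) (ℓ∤f : ¬ ℓ ∣ f) where
    InIdeal : Pol → Set
    InIdeal g = Σ Pol λ u → Σ Pol λ v → g ≋ u ⊗ f ⊕ v ⊗ ℓ

    private
      inIdeal-⊗ : ∀ {g} → InIdeal g → ∀ k → InIdeal (g ⊗ k)
      inIdeal-⊗ {g} (u , v , g≋) k = k ⊗ u , k ⊗ v ,
        ≋-trans (⊗-congˡ g≋ k) (solve 5 (λ k u v f l → (u :* f :+ v :* l) :* k := k :* u :* f :+ k :* v :* l) ≋-refl k u v f ℓ)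

      inIdeal-⊖ : ∀ {g h} → InIdeal g → InIdeal h → InIdeal (g ⊖ h)
      inIdeal-⊖ (u , v , g≋) (u' , v' , h≋) = u ⊖ u' , v ⊖ v' , ≋-trans (⊕-cong g≋ (⊝-cong h≋))
        (solve 6 (λ u v u' v' f l → (u :* f :+ v :* l) :- (u' :* f :+ v' :* l) := (u :- u') :* f :+ (v :- v') :* l) ≋-refl u v u' v' f ℓ)

      inIdeal-resp : ∀ {g h} → g ≋ h → InIdeal g → InIdeal h
      inIdeal-resp p (u , v , g≋) = u , v , ≋-trans (≋-sym p) g≋

    Inverse : Set
    Inverse = Σ Pol λ u → ℓ ∣ (u ⊗ f ⊖ oneP)

    -- Euclid's algorithm on the ideal (f, ℓ): a nonzero element of least degree, made monic, divides
    -- both f and ℓ, so by irreducibility it is 1 (it cannot be ℓ, as ℓ ∤ f).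
    inverseBelow : ∀ n g → Deg< g n → ¬ (g ≋ []) → InIdeal g → Inverse
    inverseBelow zero g b g≉[] _ = ⊥-elim (g≉[] (deg<0⇒≋[] b))
    inverseBelow (suc n) g b g≉[] g∈I with ≋[]⊎hasDegree g
    ... | inj₁ g≋[] = ⊥-elim (g≉[] g≋[])
    ... | inj₂ (e , c≢0 , bg) with inverse (coeff g e) c≢0
    ...   | c , gc≡1 = reduceBy f f∈I λ f≋g'q → reduceBy ℓ ℓ∈I λ ℓ≋g'q' → from-unit (irreducible f≋g'q ℓ≋g'q')
      where
      g' = scale c g
      g'-monic : MonicOfDegree g' e
      g'-monic = ((λ c≡0 → 0≢1 (trans (sym c≡0) c≡1)) ,
                  (λ i le → trans (coeff-scale c g i) (trans (cong (c *F_) (bg i le)) (*F-zeroʳ c)))) , c≡1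
        where c≡1 = trans (coeff-scale c g e) (trans (*F-comm _ _) gc≡1)
      g'∈I : InIdeal g'
      g'∈I = inIdeal-resp (≋-trans (⊗-comm g (c ∷ [])) ([c]⊗≋scale c g)) (inIdeal-⊗ g∈I (c ∷ []))
      open DivisionByMonic g' e g'-monic using () renaming (divMod to divMod-g')
      f∈I : InIdeal f
      f∈I = oneP , [] , ≋-sym (≋-trans (⊕-cong (⊗-identityˡ f) ≋-refl) (⊕-identityʳ f))
      ℓ∈I : InIdeal ℓ
      ℓ∈I = [] , oneP , ≋-sym (⊗-identityˡ ℓ)
      reduceBy : ∀ x → InIdeal x → ((Σ Pol λ q → x ≋ g' ⊗ q) → Inverse) → Inverse
      reduceBy x x∈I k with divMod-g' x
      ... | q , r , x≋ , r<e with ≋[]⊎hasDegree r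
      ...   | inj₁ r≋[] = k (q , ≋-trans x≋ (≋-trans (⊕-cong (≋-refl {g' ⊗ q}) r≋[]) (⊕-identityʳ _)))
      ...   | inj₂ (_ , r-deg) = inverseBelow n r (deg<-mono {r} r<e (ℕ.≤-pred (hasDegree⇒< {g} (c≢0 , bg) b)))
                (hasDegree⇒≉[] r-deg)
                (inIdeal-resp (≋-trans (⊕-cong x≋ (≋-refl {⊝ (g' ⊗ q)})) (solve 3 (λ a q r → a :* q :+ r :- a :* q := r) ≋-refl g' q r))
                  (inIdeal-⊖ x∈I (inIdeal-⊗ g'∈I q)))
      irreducible : (Σ Pol λ q → f ≋ g' ⊗ q) → (Σ Pol λ q → ℓ ≋ g' ⊗ q) → g' ≋ oneP
      irreducible (q , f≋) (q' , ℓ≋) with proj₂ (proj₂ ℓ-irr) (strip g') (monicOfDegree⇒Monic g' g'-monic)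
                                         (∣⇒∣P (∣-respˡ (≋-sym (strip-≋ g')) (divides q' (≋-sym ℓ≋))))
      ... | inj₁ g'≈1 = ≋-trans (≋-sym (strip-≋ g')) (≈P⇒≋ g'≈1)
      ... | inj₂ g'≈ℓ = ⊥-elim (ℓ∤f (∣-respˡ (≋-trans (≋-sym (strip-≋ g')) (≈P⇒≋ g'≈ℓ)) (divides q (≋-sym f≋))))
      from-unit : g' ≋ oneP → Inverse
      from-unit g'≋1 with g'∈I
      ... | u , v , g'≋ = u , divides (⊝ v) (≋-sym (≋-trans (⊕-cong (≋-refl {u ⊗ f}) (⊝-cong (≋-trans (≋-sym g'≋1) g'≋)))
            (solve 4 (λ u f v l → u :* f :- (u :* f :+ v :* l) := l :* (:- v)) ≋-refl u f v ℓ)))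

    inverseMod : Inverse
    inverseMod = inverseBelow (suc d) ℓ (proj₂ (proj₁ ℓ-monic)) (hasDegree⇒≉[] (proj₁ ℓ-monic))
                   ([] , oneP , ≋-sym (⊗-identityˡ ℓ))

  euclidsLemma : ∀ x y → ℓ ∣ (x ⊗ y) → ¬ ℓ ∣ x → ℓ ∣ y
  euclidsLemma x y ℓ∣xy ℓ∤x with Bezout.inverseMod x ℓ∤x
  ... | u , ℓ∣ux-1 = ∣-respʳ (solve 3 (λ u x y → u :* (x :* y) :- (u :* x :- con (ℤ.+ 1)) :* y := y) ≋-refl u x y)
                       (∣-⊖ (∣-⊗ˡ ℓ∣xy u) (∣-⊗ʳ ℓ∣ux-1 y))

  ℓ⊗-cancel : ∀ f g → ℓ ⊗ f ≋ ℓ ⊗ g → f ≋ g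
  ℓ⊗-cancel f g p = ≋-trans (solve 2 (λ f g → f := (f :- g) :+ g) ≋-refl f g) (≋-trans (⊕-cong f-g≋[] (≋-refl {g})) ≋-refl)
    where
    ℓ[f-g]≋[] : ℓ ⊗ (f ⊖ g) ≋ []
    ℓ[f-g]≋[] = ≋-trans (solve 3 (λ l f g → l :* (f :- g) := l :* f :- l :* g) ≋-refl ℓ f g)
      (≋-trans (⊕-cong p (≋-refl {⊝ (ℓ ⊗ g)})) (⊕-inverseʳ (ℓ ⊗ g)))
    f-g≋[] : f ⊖ g ≋ []
    f-g≋[] = multiple-deg<⇒≋[] ℓ[f-g]≋[] (deg<-[] d)

  monic-∣pow-ℓ⇒≋oneP : ∀ k {g} → Monic g → g ∣ pow ℓ k → ¬ ℓ ∣ g → g ≋ oneP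
  monic-∣pow-ℓ⇒≋oneP zero g-monic g∣1 _ = monic-∣oneP⇒≋oneP g-monic g∣1
  monic-∣pow-ℓ⇒≋oneP (suc k) {g} g-monic (divides h gh≋) ℓ∤g =
    monic-∣pow-ℓ⇒≋oneP k g-monic (divides h' (ℓ⊗-cancel _ _ ℓgh'≋)) ℓ∤g
    where
    ℓ∣h = euclidsLemma g h (∣-respʳ (≋-sym gh≋) (f∣f⊗g ℓ (pow ℓ k))) ℓ∤g
    h' = _∣_.quotient ℓ∣h
    ℓgh'≋ : ℓ ⊗ (g ⊗ h') ≋ ℓ ⊗ pow ℓ k
    ℓgh'≋ = ≋-trans (solve 3 (λ l g h → l :* (g :* h) := g :* (l :* h)) ≋-refl ℓ g h')
              (≋-trans (⊗-congʳ g (_∣_.equation ℓ∣h)) gh≋)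

  coprime-ℓ^k⇒∤ : ∀ x k → 1 ≤ k → Coprime x (ℓ ^P k) → ¬ ℓ ∣ x
  coprime-ℓ^k⇒∤ x (suc k) _ cop ℓ∣x = ℓ≉oneP (≈P⇒≋ (cop ℓ (proj₁ ℓ-irr) (∣⇒∣P ℓ∣x)
    (∣⇒∣P (∣-respʳ (≋-sym (^P-≋ ℓ (suc k))) (f∣f⊗g ℓ (pow ℓ k))))))

  ∤⇒coprime-ℓ^k : ∀ x k → ¬ ℓ ∣ x → Coprime x (ℓ ^P k)
  ∤⇒coprime-ℓ^k x k ℓ∤x g g-monic g∣x g∣ℓ^k with ∣? g
  ... | yes ℓ∣g = ⊥-elim (ℓ∤x (∣-trans ℓ∣g (∣P⇒∣ g∣x)))
  ... | no ℓ∤g = ≋⇒≈P (monic-∣pow-ℓ⇒≋oneP k g-monic (∣-respʳ (^P-≋ ℓ k) (∣P⇒∣ g∣ℓ^k)) ℓ∤g)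

  monicOfDegree-pow-ℓ : ∀ k → MonicOfDegree (pow ℓ k) (k ℕ.* d)
  monicOfDegree-pow-ℓ zero = ((λ 1≡0 → 0≢1 (sym 1≡0)) , λ { (suc i) _ → refl }) , refl
  monicOfDegree-pow-ℓ (suc k) = monicOfDegree-⊗ ℓ (pow ℓ k) ℓ-monic (monicOfDegree-pow-ℓ k)

  deg-ℓ^k : ∀ k → deg (ℓ ^P k) ≡ k ℕ.* d
  deg-ℓ^k k = hasDegree⇒deg≡ (ℓ ^P k) (hasDegree-cong (≋-sym (^P-≋ ℓ k)) (proj₁ (monicOfDegree-pow-ℓ k)))

  monic-ℓ^k : ∀ k → Monic (ℓ ^P k)
  monic-ℓ^k zero = refl
  monic-ℓ^k (suc k) = monicOfDegree⇒Monic (ℓ ⊗ (ℓ ^P k))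
    (monicOfDegree-⊗ ℓ (ℓ ^P k) ℓ-monic (monic⇒monicOfDegree (ℓ ^P k) (monic-ℓ^k k)))

  χ-ℓ^k : ∀ {χ} → IsJacobi χ → ∀ σ k → χ σ (ℓ ^P k) ≡ χ σ ℓ ℤ.^ k
  χ-ℓ^k J σ zero = IsJacobi.at-one J σ
  χ-ℓ^k {χ} J σ (suc k) = trans (IsJacobi.mult J σ ℓ (ℓ ^P k) (proj₁ ℓ-irr) (monic-ℓ^k k)) (cong (χ σ ℓ ℤ.*_) (χ-ℓ^k J σ k))

module ResiduesMod (F : FiniteField) {ℓ : Poly.Pol F} (ℓ-irr : Poly.MonicIrreducible F ℓ) where
  open MonicIrreducibleModulus F {ℓ} ℓ-irr public
  open ResidueEnumeration F public using (Polys<; Stripped; ≋⇒≡-stripped; length-Polys<; Polys<-complete; Polys<-sound; unique-Polys<; 1+1≢0)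
  open PolynomialSolver

  infix 4 _≡ℓ_
  record _≡ℓ_ (f g : Pol) : Set where
    constructor ≡ℓ-intro
    field ℓ∣difference : ℓ ∣ (f ⊖ g)
  open _≡ℓ_ public

  ≡ℓ-sym : ∀ {f g} → f ≡ℓ g → g ≡ℓ f
  ≡ℓ-sym {f} {g} (≡ℓ-intro p) = ≡ℓ-intro (∣-respʳ (solve 2 (λ f g → :- (f :- g) := g :- f) ≋-refl f g) (∣-⊝ p))

  ≡ℓ-trans : ∀ {f g h} → f ≡ℓ g → g ≡ℓ h → f ≡ℓ h
  ≡ℓ-trans {f} {g} {h} (≡ℓ-intro p) (≡ℓ-intro p') =
    ≡ℓ-intro (∣-respʳ (solve 3 (λ f g h → (f :- g) :+ (g :- h) := f :- h) ≋-refl f g h) (∣-⊕ p p'))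

  ∣-resp-≡ℓ : ∀ {f g} → f ≡ℓ g → ℓ ∣ f → ℓ ∣ g
  ∣-resp-≡ℓ {f} {g} (≡ℓ-intro p) ℓ∣f = ∣-respʳ (solve 2 (λ f g → f :- (f :- g) := g) ≋-refl f g) (∣-⊖ ℓ∣f p)

  ∤-resp-≡ℓ : ∀ {f g} → f ≡ℓ g → ¬ ℓ ∣ f → ¬ ℓ ∣ g
  ∤-resp-≡ℓ f≡g ℓ∤f ℓ∣g = ℓ∤f (∣-resp-≡ℓ (≡ℓ-sym f≡g) ℓ∣g)

  ≋⇒≡ℓ : ∀ {f g} → f ≋ g → f ≡ℓ g
  ≋⇒≡ℓ {f} {g} f≋g = ≡ℓ-intro (∣-respʳ (≋-sym (≋-trans (⊕-cong f≋g (≋-refl {⊝ g})) (⊕-inverseʳ g))) (∣-[] ℓ))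

  ≡ℓ-square : ∀ {f g} → f ≡ℓ g → f ⊗ f ≡ℓ g ⊗ g
  ≡ℓ-square {f} {g} (≡ℓ-intro p) =
    ≡ℓ-intro (∣-respʳ (solve 2 (λ f g → (f :- g) :* (f :+ g) := f :* f :- g :* g) ≋-refl f g) (∣-⊗ʳ p (f ⊕ g)))

  ℓ∤? : ∀ f → Dec (¬ ℓ ∣ f)
  ℓ∤? f with ∣? f
  ... | yes ℓ∣f = no λ ℓ∤f → ℓ∤f ℓ∣f
  ... | no ℓ∤f = yes ℓ∤f

  abstract
    residue : Pol → Pol
    residue f = strip (rem f)

    residue-∈ : ∀ f → residue f ∈ Polys< d
    residue-∈ f = Polys<-complete d (strip-idem (rem f)) (deg<-cong (≋-sym (strip-≋ (rem f))) (rem-deg< f))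

    ≡ℓ-residue : ∀ f → f ≡ℓ residue f
    ≡ℓ-residue f = ≡ℓ-intro (∣-respʳ (⊕-cong (≋-refl {f}) (⊝-cong (≋-sym (strip-≋ (rem f))))) (∣-⊖rem f))

  ≡ℓ⇒≡-Polys< : ∀ {τ τ'} → τ ∈ Polys< d → τ' ∈ Polys< d → τ ≡ℓ τ' → τ ≡ τ'
  ≡ℓ⇒≡-Polys< τ∈ τ'∈ (≡ℓ-intro τ≡τ') with Polys<-sound d τ∈ | Polys<-sound d τ'∈
  ... | (s , b) | (s' , b') = ≋⇒≡-stripped s s' (remainder-unique _ _ b b' τ≡τ')

  []∈Polys< : [] ∈ Polys< d
  []∈Polys< = Polys<-complete d refl (deg<-[] d)

  ℓ∣oneP⊕oneP⇒1+1≡0 : ℓ ∣ (oneP ⊕ oneP) → 1# +F 1# ≡ 0#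
  ℓ∣oneP⊕oneP⇒1+1≡0 ℓ∣2 =
    at (remainder-unique (oneP ⊕ oneP) [] (deg<-mono {oneP ⊕ oneP} (λ { ℕ.zero () ; (suc i) _ → refl }) 1≤d) (deg<-[] d)
    (∣-respʳ (≋-sym (⊕-identityʳ (oneP ⊕ oneP))) ℓ∣2)) 0

  private
    -P-square-≋ : ∀ τ y → (τ -P (y *P y)) ≋ τ ⊖ y ⊗ y
    -P-square-≋ τ y = ≋-trans (-P-≋ τ (y *P y)) (⊕-cong (≋-refl {τ}) (⊝-cong (*P-≋ y y)))

  ∣P⇒≡ℓ-square : ∀ τ y → ℓ ∣P (τ -P (y *P y)) → τ ≡ℓ y ⊗ y
  ∣P⇒≡ℓ-square τ y p = ≡ℓ-intro (∣-respʳ (-P-square-≋ τ y) (∣P⇒∣ p))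

  ≡ℓ-square⇒∣P : ∀ τ y → τ ≡ℓ y ⊗ y → ℓ ∣P (τ -P (y *P y))
  ≡ℓ-square⇒∣P τ y (≡ℓ-intro p) = ∣⇒∣P (∣-respʳ (≋-sym (-P-square-≋ τ y)) p)

  IsSquare : Pol → Set
  IsSquare τ = NonzeroSquareMod τ ℓ

  private
    -- a square root may be searched for among the residues
    squareRoot? : ∀ τ → Dec (∃ λ y → ℓ ∣P (τ -P (y *P y)))
    squareRoot? τ with any? (λ y → map′ ∣⇒∣P ∣P⇒∣ (∣? (τ -P (y *P y)))) (Polys< d)
    ... | yes root = yes (Any.satisfied root)
    ... | no ¬root = no λ { (y , p) → ¬root (Any.map (λ { refl → ≡ℓ-square⇒∣P τ (residue y)
            (≡ℓ-trans (∣P⇒≡ℓ-square τ y p) (≡ℓ-square (≡ℓ-residue y))) }) (residue-∈ y)) }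

  isSquare? : ∀ τ → Dec (IsSquare τ)
  isSquare? τ with ∣? τ | squareRoot? τ
  ... | yes ℓ∣τ | _ = no λ (ℓ∤τ , _) → ℓ∤τ (∣⇒∣P ℓ∣τ)
  ... | no ℓ∤τ | yes root = yes ((λ p → ℓ∤τ (∣P⇒∣ p)) , root)
  ... | no _ | no ¬root = no λ (_ , root) → ¬root root

  isSquare-resp : ∀ {τ τ'} → τ ≡ℓ τ' → IsSquare τ → IsSquare τ'
  isSquare-resp τ≡τ' (ℓ∤τ , y , p) = (λ ℓ∣τ' → ℓ∤τ (∣⇒∣P (∣-resp-≡ℓ (≡ℓ-sym τ≡τ') (∣P⇒∣ ℓ∣τ')))) ,
    y , ≡ℓ-square⇒∣P _ y (≡ℓ-trans (≡ℓ-sym τ≡τ') (∣P⇒≡ℓ-square _ y p))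

  signOf : ∀ {P : Set} → Dec P → ℤ
  signOf p = if does p then + 1 else -[1+ 0 ]

  -- On multiples of ℓ this is -1 rather than 0; every use is guarded by ℓ ∤ τ.
  legendre : Pol → ℤ
  legendre τ = signOf (isSquare? τ)

  legendre-square : ∀ τ → legendre τ ℤ.* legendre τ ≡ + 1
  legendre-square τ = signOf² (isSquare? τ)
    where
    signOf² : ∀ {P} (p : Dec P) → signOf p ℤ.* signOf p ≡ + 1
    signOf² (yes _) = refl
    signOf² (no _) = refl

  χ≡legendre : ∀ {χ} → IsJacobi χ → ∀ τ → ¬ ℓ ∣ τ → χ τ ℓ ≡ legendre τ
  χ≡legendre {χ} J τ ℓ∤τ = χ≡signOf (isSquare? τ)
    where
    χ≡signOf : (p : Dec (IsSquare τ)) → χ τ ℓ ≡ signOf p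
    χ≡signOf (yes sq) = IsJacobi.at-irr-sq J τ ℓ ℓ-irr sq
    χ≡signOf (no ¬sq) = IsJacobi.at-irr-nsq J τ ℓ ℓ-irr (λ p → ℓ∤τ (∣P⇒∣ p)) ¬sq

  legendre-resp : ∀ {τ τ'} → τ ≡ℓ τ' → legendre τ ≡ legendre τ'
  legendre-resp {τ} {τ'} τ≡τ' = signOf-⇔ (isSquare? τ) (isSquare? τ')
    where
    signOf-⇔ : (p : Dec (IsSquare τ)) (p' : Dec (IsSquare τ')) → signOf p ≡ signOf p'
    signOf-⇔ (yes _) (yes _) = refl
    signOf-⇔ (no _) (no _) = refl
    signOf-⇔ (yes sq) (no ¬sq') = ⊥-elim (¬sq' (isSquare-resp τ≡τ' sq))
    signOf-⇔ (no ¬sq) (yes sq') = ⊥-elim (¬sq (isSquare-resp (≡ℓ-sym τ≡τ') sq'))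

  -- Each polynomial of degree < d + n is uniquely τ + ℓ ρ with deg τ < d and deg ρ < n.
  ∑-Polys<-periodic : ∀ (g : Pol → ℤ) → (∀ {σ σ'} → σ ≡ℓ σ' → g σ ≡ g σ') →
                      ∀ n → ∑ g (Polys< (d ℕ.+ n)) ≡ + (q ^ n) ℤ.* ∑ g (Polys< d)
  ∑-Polys<-periodic g g-resp n = begin
    ∑ g (Polys< (d ℕ.+ n))
      ≡⟨ ∑-⊆-unique g (map lift pairs) (Polys< (d ℕ.+ n)) unique-lifts (unique-Polys< (d ℕ.+ n)) length-lifts lift-∈ ⟨
    ∑ g (map lift pairs)                   ≡⟨ ∑-map g lift pairs ⟩
    ∑ (λ p → g (lift p)) pairs             ≡⟨ ∑-cong pairs (λ p _ → g-resp (lift≡ℓ p)) ⟩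
    ∑ (λ p → g (proj₁ p)) pairs            ≡⟨ ∑-cartesianProduct g (Polys< d) (Polys< n) ⟩
    + length (Polys< n) ℤ.* ∑ g (Polys< d) ≡⟨ cong (λ m → + m ℤ.* ∑ g (Polys< d)) (length-Polys< n) ⟩
    + (q ^ n) ℤ.* ∑ g (Polys< d)           ∎
    where
    open ≡-Reasoning
    pairs = cartesianProduct (Polys< d) (Polys< n)
    lift : Pol × Pol → Pol
    lift (τ , ρ) = strip (τ ⊕ ℓ ⊗ ρ)

    lift≡ℓ : ∀ p → lift p ≡ℓ proj₁ p
    lift≡ℓ (τ , ρ) = ≡ℓ-intro (divides ρ (≋-sym (≋-trans (⊕-cong (strip-≋ (τ ⊕ ℓ ⊗ ρ)) (≋-refl {⊝ τ}))
                       (solve 3 (λ t l p → (t :+ l :* p) :- t := l :* p) ≋-refl τ ℓ ρ))))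

    lift-injective : ∀ {x y} → x ∈ pairs → y ∈ pairs → lift x ≡ lift y → x ≡ y
    lift-injective {τ , ρ} {τ' , ρ'} x∈ y∈ e
      with ∈.∈-cartesianProduct⁻ (Polys< d) (Polys< n) x∈ | ∈.∈-cartesianProduct⁻ (Polys< d) (Polys< n) y∈
    ... | (τ∈ , ρ∈) | (τ'∈ , ρ'∈) = cong₂ _,_ τ≡τ' ρ≡ρ'
      where
      ℓ[ρ'-ρ]≋ : ℓ ⊗ (ρ' ⊖ ρ) ≋ τ ⊖ τ'
      ℓ[ρ'-ρ]≋ = ≋-trans (solve 4 (λ l p p' t' → l :* (p' :- p) := (t' :+ l :* p') :- (t' :+ l :* p)) ≋-refl ℓ ρ ρ' τ')
        (≋-trans (⊕-cong (≋-sym (≈P⇒≋ e)) (≋-refl {⊝ (τ' ⊕ ℓ ⊗ ρ)}))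
          (solve 3 (λ t t' lp → (t :+ lp) :- (t' :+ lp) := t :- t') ≋-refl τ τ' (ℓ ⊗ ρ)))
      ρ'-ρ≋[] : ρ' ⊖ ρ ≋ []
      ρ'-ρ≋[] = multiple-deg<⇒≋[] ℓ[ρ'-ρ]≋
        (deg<-⊕ {τ} {⊝ τ'} (proj₂ (Polys<-sound d τ∈)) (deg<-⊝ {τ'} (proj₂ (Polys<-sound d τ'∈))))
      ρ≡ρ' : ρ ≡ ρ'
      ρ≡ρ' = ≋⇒≡-stripped (proj₁ (Polys<-sound n ρ∈)) (proj₁ (Polys<-sound n ρ'∈))
        (≋-sym (≋-trans (solve 2 (λ a b → a := (a :- b) :+ b) ≋-refl ρ' ρ) (≋-trans (⊕-cong ρ'-ρ≋[] (≋-refl {ρ})) ≋-refl)))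
      τ≡τ' : τ ≡ τ'
      τ≡τ' = ≡ℓ⇒≡-Polys< τ∈ τ'∈ (≡ℓ-intro (divides (ρ' ⊖ ρ) ℓ[ρ'-ρ]≋))

    unique-lifts = unique-map lift pairs (Unique.cartesianProduct⁺ (unique-Polys< d) (unique-Polys< n)) lift-injective

    deg<-ℓ⊗ : ∀ m {ρ} → Deg< ρ m → Deg< (ℓ ⊗ ρ) (d ℕ.+ m)
    deg<-ℓ⊗ ℕ.zero {ρ} b = deg<-cong (≋-sym (≋-trans (⊗-congʳ ℓ (deg<0⇒≋[] {ρ} b)) (⊗-zeroʳ ℓ))) (deg<-[] _)
    deg<-ℓ⊗ (suc m) {ρ} b = subst (Deg< (ℓ ⊗ ρ)) (sym (ℕ.+-suc d m)) (proj₂ (coeff-⊗-top ℓ ρ d m (proj₂ (proj₁ ℓ-monic)) b))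

    lift-∈ : ∀ {x} → x ∈ map lift pairs → x ∈ Polys< (d ℕ.+ n)
    lift-∈ x∈ with ∈.∈-map⁻ lift x∈
    ... | (τ , ρ) , p∈ , refl with ∈.∈-cartesianProduct⁻ (Polys< d) (Polys< n) p∈
    ...   | (τ∈ , ρ∈) = Polys<-complete (d ℕ.+ n) (strip-idem (τ ⊕ ℓ ⊗ ρ)) (deg<-cong (≋-sym (strip-≋ (τ ⊕ ℓ ⊗ ρ)))
             (deg<-⊕ {τ} {ℓ ⊗ ρ} (deg<-mono {τ} (proj₂ (Polys<-sound d τ∈)) (ℕ.m≤m+n d n)) (deg<-ℓ⊗ n (proj₂ (Polys<-sound n ρ∈)))))

    length-lifts : length (map lift pairs) ≡ length (Polys< (d ℕ.+ n))
    length-lifts = begin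
      length (map lift pairs)                    ≡⟨ List.length-map lift pairs ⟩
      length pairs                               ≡⟨ length-cartesianProductWith _,_ (Polys< d) (Polys< n) ⟩
      length (Polys< d) ℕ.* length (Polys< n)    ≡⟨ cong₂ ℕ._*_ (length-Polys< d) (length-Polys< n) ⟩
      q ^ d ℕ.* q ^ n                            ≡⟨ ℕ.^-distribˡ-+-* q d n ⟨
      q ^ (d ℕ.+ n)                              ≡⟨ length-Polys< (d ℕ.+ n) ⟨
      length (Polys< (d ℕ.+ n))                  ∎

module LegendreSums (F : FiniteField) (q-odd : FiniteField.q F % 2 ≡ 1)
                    {ℓ : Poly.Pol F} (ℓ-irr : Poly.MonicIrreducible F ℓ) where
  open ResiduesMod F {ℓ} ℓ-irr public

  _≟P_ : (f g : Pol) → Dec (f ≡ g)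
  _≟P_ = List.≡-dec _≟_

  infix 4 _≡ℓ?_
  _≡ℓ?_ : ∀ f g → Dec (f ≡ℓ g)
  f ≡ℓ? g with ∣? (f ⊖ g)
  ... | yes ℓ∣f-g = yes (≡ℓ-intro ℓ∣f-g)
  ... | no ℓ∤f-g = no λ f≡g → ℓ∤f-g (ℓ∣difference f≡g)

  units : List Pol
  units = filter ℓ∤? (Polys< d)

  unique-units : Unique units
  unique-units = Unique.filter⁺ ℓ∤? (unique-Polys< d)

  ∈units⁻ : ∀ {τ} → τ ∈ units → τ ∈ Polys< d × ¬ ℓ ∣ τ
  ∈units⁻ = ∈.∈-filter⁻ ℓ∤?

  ∈units⁺ : ∀ {τ} → τ ∈ Polys< d → ¬ ℓ ∣ τ → τ ∈ units
  ∈units⁺ = ∈.∈-filter⁺ ℓ∤?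

  ℓ∤⊗ : ∀ {f g} → ¬ ℓ ∣ f → ¬ ℓ ∣ g → ¬ ℓ ∣ (f ⊗ g)
  ℓ∤⊗ {f} {g} ℓ∤f ℓ∤g ℓ∣fg = ℓ∤g (euclidsLemma f g ℓ∣fg ℓ∤f)

  ≡ℓ-square-roots : ∀ τ t → τ ⊗ τ ≡ℓ t ⊗ t → τ ≡ℓ t ⊎ τ ≡ℓ ⊝ t
  ≡ℓ-square-roots τ t (≡ℓ-intro ℓ∣τ²-t²) with ∣? (τ ⊖ t)
  ... | yes ℓ∣τ-t = inj₁ (≡ℓ-intro ℓ∣τ-t)
  ... | no ℓ∤τ-t = inj₂ (≡ℓ-intro (∣-respʳ (solve 2 (λ a b → a :+ b := a :- (:- b)) ≋-refl τ t)
    (euclidsLemma (τ ⊖ t) (τ ⊕ t) (∣-respʳ (solve 2 (λ a b → a :* a :- b :* b := (a :- b) :* (a :+ b)) ≋-refl τ t) ℓ∣τ²-t²) ℓ∤τ-t)))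
    where open PolynomialSolver

  -- since 2 is invertible, t and -t are distinct modulo ℓ unless ℓ ∣ t
  ≢ℓ-⊝ : ∀ {t} → ¬ ℓ ∣ t → ¬ (t ≡ℓ ⊝ t)
  ≢ℓ-⊝ {t} ℓ∤t (≡ℓ-intro ℓ∣t+t) = ℓ∤t (euclidsLemma (oneP ⊕ oneP) t
    (∣-respʳ (solve 1 (λ t → t :- (:- t) := (con (ℤ.+ 1) :+ con (ℤ.+ 1)) :* t) ≋-refl t) ℓ∣t+t)
    (λ ℓ∣2 → 1+1≢0 q-odd (ℓ∣oneP⊕oneP⇒1+1≡0 ℓ∣2)))
    where open PolynomialSolver

  count-squares-of : ∀ {τ} → τ ∈ units → ∑ (λ y → when (y ≡ℓ? τ ⊗ τ) (+ 1)) units ≡ + 1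
  count-squares-of {τ} τ∈ = trans (∑-cong units (λ y y∈ → when-⇔ (y ≡ℓ? τ ⊗ τ) (y ≟P y₀) (to y∈) (from y∈) (+ 1)))
                                (∑-indicator _≟P_ y₀ units unique-units y₀∈)
    where
    y₀ = residue (τ ⊗ τ)
    ℓ∤τ = proj₂ (∈units⁻ τ∈)
    y₀∈ : y₀ ∈ units
    y₀∈ = ∈units⁺ (residue-∈ (τ ⊗ τ)) (∤-resp-≡ℓ (≡ℓ-residue (τ ⊗ τ)) (ℓ∤⊗ ℓ∤τ ℓ∤τ))
    to : ∀ {y} → y ∈ units → y ≡ℓ τ ⊗ τ → y ≡ y₀
    to y∈ y≡ = ≡ℓ⇒≡-Polys< (proj₁ (∈units⁻ y∈)) (residue-∈ (τ ⊗ τ)) (≡ℓ-trans y≡ (≡ℓ-residue (τ ⊗ τ)))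
    from : ∀ {y} → y ∈ units → y ≡ y₀ → y ≡ℓ τ ⊗ τ
    from _ refl = ≡ℓ-sym (≡ℓ-residue (τ ⊗ τ))

  count-square-roots : ∀ {y} → y ∈ units → ∑ (λ τ → when (y ≡ℓ? τ ⊗ τ) (+ 1)) units ≡ + 2 ℤ.* when (isSquare? y) (+ 1)
  count-square-roots {y} y∈ with isSquare? y
  ... | no ¬sq = ∑-zero _ units λ τ _ → noRoot τ
    where
    noRoot : ∀ τ → when (y ≡ℓ? τ ⊗ τ) (+ 1) ≡ + 0
    noRoot τ with y ≡ℓ? τ ⊗ τ
    ... | yes y≡τ² = ⊥-elim (¬sq ((λ p → proj₂ (∈units⁻ y∈) (∣P⇒∣ p)) , τ , ≡ℓ-square⇒∣P y τ y≡τ²))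
    ... | no _ = refl
  ... | yes (_ , t , p) = begin
    ∑ (λ τ → when (y ≡ℓ? τ ⊗ τ) (+ 1)) units                                   ≡⟨ ∑-cong units (λ τ τ∈ → split τ∈) ⟩
    ∑ (λ τ → when (τ ≟P t₀) (+ 1) ℤ.+ when (τ ≟P t₁) (+ 1)) units               ≡⟨ ∑-+ _ _ units ⟩
    ∑ (λ τ → when (τ ≟P t₀) (+ 1)) units ℤ.+ ∑ (λ τ → when (τ ≟P t₁) (+ 1)) units
      ≡⟨ cong₂ ℤ._+_ (∑-indicator _≟P_ t₀ units unique-units t₀∈) (∑-indicator _≟P_ t₁ units unique-units t₁∈) ⟩
    + 2                                                                        ∎
    where
    open ≡-Reasoning
    open PolynomialSolver
    t₀ = residue t
    t₁ = residue (⊝ t₀)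
    y≡t₀² : y ≡ℓ t₀ ⊗ t₀
    y≡t₀² = ≡ℓ-trans (∣P⇒≡ℓ-square y t p) (≡ℓ-square (≡ℓ-residue t))
    t₁≡-t₀ : t₁ ≡ℓ ⊝ t₀
    t₁≡-t₀ = ≡ℓ-sym (≡ℓ-residue (⊝ t₀))
    y≡t₁² : y ≡ℓ t₁ ⊗ t₁
    y≡t₁² = ≡ℓ-trans y≡t₀² (≡ℓ-trans (≋⇒≡ℓ (solve 1 (λ t → t :* t := (:- t) :* (:- t)) ≋-refl t₀))
                                      (≡ℓ-square (≡ℓ-sym t₁≡-t₀)))
    ℓ∤t₀ : ¬ ℓ ∣ t₀
    ℓ∤t₀ ℓ∣t₀ = proj₂ (∈units⁻ y∈) (∣-resp-≡ℓ (≡ℓ-sym y≡t₀²) (∣-⊗ʳ ℓ∣t₀ t₀))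
    ℓ∤t₁ : ¬ ℓ ∣ t₁
    ℓ∤t₁ ℓ∣t₁ = ℓ∤t₀ (∣-respʳ (solve 1 (λ t → :- (:- t) := t) ≋-refl t₀) (∣-⊝ (∣-resp-≡ℓ t₁≡-t₀ ℓ∣t₁)))
    t₀∈ = ∈units⁺ (residue-∈ t) ℓ∤t₀
    t₁∈ = ∈units⁺ (residue-∈ (⊝ t₀)) ℓ∤t₁
    t₀≢t₁ : t₀ ≢ t₁
    t₀≢t₁ t₀≡t₁ = ≢ℓ-⊝ ℓ∤t₀ (subst (_≡ℓ ⊝ t₀) (sym t₀≡t₁) t₁≡-t₀)
    root⇒t₀⊎t₁ : ∀ {τ} → τ ∈ units → y ≡ℓ τ ⊗ τ → τ ≡ t₀ ⊎ τ ≡ t₁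
    root⇒t₀⊎t₁ {τ} τ∈ y≡τ² = Sum.map (≡ℓ⇒≡-Polys< τ∈d (residue-∈ t))
                                       (λ τ≡-t₀ → ≡ℓ⇒≡-Polys< τ∈d (residue-∈ (⊝ t₀)) (≡ℓ-trans τ≡-t₀ (≡ℓ-residue (⊝ t₀))))
                                       (≡ℓ-square-roots τ t₀ (≡ℓ-trans (≡ℓ-sym y≡τ²) y≡t₀²))
      where τ∈d = proj₁ (∈units⁻ τ∈)
    split : ∀ {τ} → τ ∈ units → when (y ≡ℓ? τ ⊗ τ) (+ 1) ≡ when (τ ≟P t₀) (+ 1) ℤ.+ when (τ ≟P t₁) (+ 1)
    split {τ} τ∈ = when-⊎ (y ≡ℓ? τ ⊗ τ) (τ ≟P t₀) (τ ≟P t₁) (root⇒t₀⊎t₁ τ∈) t₀⊎t₁⇒root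
                     (λ (τ≡t₀ , τ≡t₁) → t₀≢t₁ (trans (sym τ≡t₀) τ≡t₁))
      where
      t₀⊎t₁⇒root : τ ≡ t₀ ⊎ τ ≡ t₁ → y ≡ℓ τ ⊗ τ
      t₀⊎t₁⇒root (inj₁ refl) = y≡t₀²
      t₀⊎t₁⇒root (inj₂ refl) = y≡t₁²

  -- Counting pairs (τ , y) of units with y ≡ τ² in both orders: there are as many squares as non-squares.
  ∑-legendre : ∑ (λ τ → when (ℓ∤? τ) (legendre τ)) (Polys< d) ≡ + 0
  ∑-legendre = begin
    ∑ (λ τ → when (ℓ∤? τ) (legendre τ)) (Polys< d)                             ≡⟨ ∑-filter ℓ∤? legendre (Polys< d) ⟨
    ∑ legendre units                                                          ≡⟨ ∑-cong units (λ τ _ → legendre≡ τ) ⟩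
    ∑ (λ τ → + 2 ℤ.* when (isSquare? τ) (+ 1) ℤ.+ ℤ.- + 1) units               ≡⟨ ∑-+ _ _ units ⟩
    ∑ (λ τ → + 2 ℤ.* when (isSquare? τ) (+ 1)) units ℤ.+ ∑ (λ _ → ℤ.- + 1) units
      ≡⟨ cong₂ ℤ._+_ twice-#squares (∑-const (ℤ.- + 1) units) ⟩
    + length units ℤ.* + 1 ℤ.+ + length units ℤ.* ℤ.- + 1
      ≡⟨ solve 1 (λ n → n :* con (+ 1) :+ n :* con (ℤ.- + 1) := con (+ 0)) refl (+ length units) ⟩
    + 0                                                                       ∎
    where
    open ≡-Reasoning
    open +-*-Solver
    legendre≡ : ∀ τ → legendre τ ≡ + 2 ℤ.* when (isSquare? τ) (+ 1) ℤ.+ ℤ.- + 1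
    legendre≡ τ with isSquare? τ
    ... | yes _ = refl
    ... | no _ = refl
    twice-#squares : ∑ (λ τ → + 2 ℤ.* when (isSquare? τ) (+ 1)) units ≡ + length units ℤ.* + 1
    twice-#squares = trans (∑-cong units (λ y y∈ → sym (count-square-roots y∈)))
               (trans (∑-comm (λ τ y → when (y ≡ℓ? τ ⊗ τ) (+ 1)) units units)
               (trans (∑-cong units (λ τ τ∈ → count-squares-of τ∈)) (∑-const (+ 1) units)))

  ∑-units : ∑ (λ τ → when (ℓ∤? τ) (+ 1)) (Polys< d) ≡ + (q ^ d) ℤ.- + 1
  ∑-units = begin
    ∑ (λ τ → when (ℓ∤? τ) (+ 1)) (Polys< d)                          ≡⟨ ∑-cong (Polys< d) (λ τ τ∈ → pointwise τ∈) ⟩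
    ∑ (λ τ → + 1 ℤ.+ ℤ.- when (τ ≟P []) (+ 1)) (Polys< d)           ≡⟨ ∑-+ _ _ (Polys< d) ⟩
    ∑ (λ _ → + 1) (Polys< d) ℤ.+ ∑ (λ τ → ℤ.- when (τ ≟P []) (+ 1)) (Polys< d)
      ≡⟨ cong₂ ℤ._+_ (trans (∑-const (+ 1) (Polys< d)) (ℤ.*-identityʳ (+ length (Polys< d))))
                     (trans (∑-neg _ (Polys< d)) (cong ℤ.-_ (∑-indicator _≟P_ [] (Polys< d) (unique-Polys< d) []∈Polys<))) ⟩
    + length (Polys< d) ℤ.- + 1                                      ≡⟨ cong (λ n → + n ℤ.- + 1) (length-Polys< d) ⟩
    + (q ^ d) ℤ.- + 1                                                ∎
    where
    open ≡-Reasoning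
    pointwise : ∀ {τ} → τ ∈ Polys< d → when (ℓ∤? τ) (+ 1) ≡ + 1 ℤ.+ ℤ.- when (τ ≟P []) (+ 1)
    pointwise {τ} τ∈ with ℓ∤? τ | τ ≟P []
    ... | yes ℓ∤[] | yes refl = ⊥-elim (ℓ∤[] (∣-[] ℓ))
    ... | yes _ | no _ = refl
    ... | no _ | yes refl = refl
    ... | no ℓ∣τ | no τ≢[] =
      ⊥-elim (ℓ∣τ λ ℓ∣τ → τ≢[] (≡ℓ⇒≡-Polys< τ∈ []∈Polys< (≡ℓ-intro (∣-respʳ (≋-sym (⊕-identityʳ τ)) ℓ∣τ))))

module CharacterSum (F : FiniteField) (q-odd : FiniteField.q F % 2 ≡ 1)
                    (coprime? : ∀ x v → Dec (Poly.Coprime F x v)) (χ : Poly.Pol F → Poly.Pol F → ℤ) (J : Poly.IsJacobi F χ)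
                    (a : Poly.Pol F) {ℓ : Poly.Pol F} (ℓ-irr : Poly.MonicIrreducible F ℓ) (k : ℕ) where
  open LegendreSums F q-odd {ℓ} ℓ-irr public
  open PolynomialSolver

  form : Pol → Pol → Pol
  form r σ = (σ *P (r *P r)) -P (a *P a)

  form-≋ : ∀ r σ → form r σ ≋ σ ⊗ (r ⊗ r) ⊖ a ⊗ a
  form-≋ r σ = ≋-trans (-P-≋ (σ *P (r *P r)) (a *P a))
    (⊕-cong (≋-trans (*P-≋ σ (r *P r)) (⊗-congʳ σ (*P-≋ r r))) (⊝-cong (*P-≋ a a)))

  unitTerm : Pol → ℤ
  unitTerm σ = when (ℓ∤? σ) (legendre σ ℤ.^ k)

  summand : Pol → Pol → ℤ
  summand r σ = when (ℓ∤? (form r σ)) (unitTerm σ)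

  cSum≡∑summand : ∀ r → 1 ℕ.≤ k → cSum coprime? χ a (ℓ ^P k) r ≡ ∑ (summand r) (Polys< (k ℕ.* d))
  cSum≡∑summand r 1≤k = begin
    cSum coprime? χ a v r                                           ≡⟨ sumℤ-map (λ σ → χ σ v) (filter unit? (filter formUnit? res)) ⟩
    ∑ (λ σ → χ σ v) (filter unit? (filter formUnit? res))           ≡⟨ ∑-filter unit? (λ σ → χ σ v) (filter formUnit? res) ⟩
    ∑ (λ σ → when (unit? σ) (χ σ v)) (filter formUnit? res)         ≡⟨ ∑-filter formUnit? _ res ⟩
    ∑ (λ σ → when (formUnit? σ) (when (unit? σ) (χ σ v))) res       ≡⟨ ∑-cong res (λ σ _ → pointwise σ) ⟩
    ∑ (summand r) res                                               ≡⟨ cong (λ n → ∑ (summand r) (Polys< n)) (deg-ℓ^k k) ⟩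
    ∑ (summand r) (Polys< (k ℕ.* d))                                ∎
    where
    open ≡-Reasoning
    v = ℓ ^P k
    res = residues v
    formUnit? = λ σ → coprime? (form r σ) v
    unit? = λ σ → coprime? σ v
    coprime⇔ℓ∤ : ∀ x (p : Dec (Coprime x v)) z → when p z ≡ when (ℓ∤? x) z
    coprime⇔ℓ∤ x p = when-⇔ p (ℓ∤? x) (coprime-ℓ^k⇒∤ x k 1≤k) (∤⇒coprime-ℓ^k x k)
    χ≡legendre^k : ∀ σ (p : Dec (¬ ℓ ∣ σ)) → when p (χ σ v) ≡ when p (legendre σ ℤ.^ k)
    χ≡legendre^k σ (yes ℓ∤σ) = trans (χ-ℓ^k J σ k) (cong (ℤ._^ k) (χ≡legendre J σ ℓ∤σ))
    χ≡legendre^k σ (no _) = refl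
    pointwise : ∀ σ → when (formUnit? σ) (when (unit? σ) (χ σ v)) ≡ summand r σ
    pointwise σ = trans (coprime⇔ℓ∤ (form r σ) (formUnit? σ) _)
      (cong (when (ℓ∤? (form r σ))) (trans (coprime⇔ℓ∤ σ (unit? σ) _) (χ≡legendre^k σ (ℓ∤? σ))))

  form-resp : ∀ r {σ σ'} → σ ≡ℓ σ' → form r σ ≡ℓ form r σ'
  form-resp r {σ} {σ'} (≡ℓ-intro ℓ∣σ-σ') = ≡ℓ-intro (∣-respʳ
    (≋-sym (≋-trans (⊕-cong (form-≋ r σ) (⊝-cong (form-≋ r σ')))
      (solve 4 (λ s t r a → (s :* (r :* r) :- a :* a) :- (t :* (r :* r) :- a :* a) := (s :- t) :* (r :* r)) ≋-refl σ σ' r a)))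
    (∣-⊗ʳ ℓ∣σ-σ' (r ⊗ r)))

  summand-resp : ∀ r {σ σ'} → σ ≡ℓ σ' → summand r σ ≡ summand r σ'
  summand-resp r {σ} {σ'} σ≡σ' =
    trans (when-⇔ (ℓ∤? (form r σ)) (ℓ∤? (form r σ')) (∤-resp-≡ℓ form≡) (∤-resp-≡ℓ (≡ℓ-sym form≡)) _)
      (cong (when (ℓ∤? (form r σ')))
        (trans (when-⇔ (ℓ∤? σ) (ℓ∤? σ') (∤-resp-≡ℓ σ≡σ') (∤-resp-≡ℓ (≡ℓ-sym σ≡σ')) _)
               (cong (λ s → when (ℓ∤? σ') (s ℤ.^ k)) (legendre-resp σ≡σ'))))
    where form≡ = form-resp r σ≡σ'

  ∑unitTerm-even : k % 2 ≡ 0 → ∑ unitTerm (Polys< d) ≡ + (q ^ d) ℤ.- + 1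
  ∑unitTerm-even k-even =
    trans (∑-cong (Polys< d) (λ τ _ → cong (when (ℓ∤? τ)) (^-even (legendre τ) (legendre-square τ) k k-even))) ∑-units

  ∑unitTerm-odd : k % 2 ≡ 1 → ∑ unitTerm (Polys< d) ≡ + 0
  ∑unitTerm-odd k-odd =
    trans (∑-cong (Polys< d) (λ τ _ → cong (when (ℓ∤? τ)) (^-odd (legendre τ) (legendre-square τ) k k-odd))) ∑-legendre

  ℓ∣form⇒ℓ∣a : ∀ r σ → ℓ ∣ (σ ⊗ (r ⊗ r)) → ℓ ∣ form r σ → ℓ ∣ a
  ℓ∣form⇒ℓ∣a r σ ℓ∣σr² ℓ∣form with ∣? a
  ... | yes ℓ∣a = ℓ∣a
  ... | no ℓ∤a = ⊥-elim (ℓ∤⊗ ℓ∤a ℓ∤a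
    (∣-respʳ (solve 3 (λ s r a → s :* (r :* r) :- (s :* (r :* r) :- a :* a) := a :* a) ≋-refl σ r a)
      (∣-⊖ ℓ∣σr² (∣-respʳ (form-≋ r σ) ℓ∣form))))

  summand-ℓ∣r : ∀ r → ℓ ∣ r → ¬ ℓ ∣ a → ∀ σ → summand r σ ≡ unitTerm σ
  summand-ℓ∣r r ℓ∣r ℓ∤a σ =
    when-yes (ℓ∤? (form r σ)) (λ ℓ∣form → ℓ∤a (ℓ∣form⇒ℓ∣a r σ (∣-⊗ˡ (∣-⊗ʳ ℓ∣r r) σ) ℓ∣form)) _

  summand-ℓ∣a : ∀ r → ¬ ℓ ∣ r → ℓ ∣ a → ∀ σ → summand r σ ≡ unitTerm σ
  summand-ℓ∣a r ℓ∤r ℓ∣a σ = trans (when-⇔ (ℓ∤? (form r σ)) (ℓ∤? σ) to from _) (when-idem (ℓ∤? σ) _)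
    where
    ℓ∣a² = ∣-⊗ʳ ℓ∣a a
    to : ¬ ℓ ∣ form r σ → ¬ ℓ ∣ σ
    to ℓ∤form ℓ∣σ = ℓ∤form (∣-respʳ (≋-sym (form-≋ r σ)) (∣-⊖ (∣-⊗ʳ ℓ∣σ (r ⊗ r)) ℓ∣a²))
    from : ¬ ℓ ∣ σ → ¬ ℓ ∣ form r σ
    from ℓ∤σ ℓ∣form = ℓ∤⊗ ℓ∤σ (ℓ∤⊗ ℓ∤r ℓ∤r)
      (∣-respʳ (solve 3 (λ s r a → (s :* (r :* r) :- a :* a) :+ a :* a := s :* (r :* r)) ≋-refl σ r a)
        (∣-⊕ (∣-respʳ (form-≋ r σ) ℓ∣form) ℓ∣a²))

  -- With u r ≡ 1 (mod ℓ), σ r² - a² ≡ (σ - (u a)²) r², so exactly one residue σ makes it a non-unit,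
  -- and that σ is the nonzero square (u a)².
  ∑summand-ℓ∤ra : ∀ r → ¬ ℓ ∣ r → ¬ ℓ ∣ a → ∑ (summand r) (Polys< d) ≡ ∑ unitTerm (Polys< d) ℤ.- + 1
  ∑summand-ℓ∤ra r ℓ∤r ℓ∤a = ∑-except _≟P_ (summand r) unitTerm τ₀ (Polys< d) (unique-Polys< d) τ₀∈ unitTerm-τ₀ summand≡
    where
    u = proj₁ (Bezout.inverseMod r ℓ∤r)
    ℓ∣ur-1 = proj₂ (Bezout.inverseMod r ℓ∤r)
    τ₀ = residue ((u ⊗ a) ⊗ (u ⊗ a))
    τ₀∈ = residue-∈ ((u ⊗ a) ⊗ (u ⊗ a))
    τ₀≡ : τ₀ ≡ℓ (u ⊗ a) ⊗ (u ⊗ a)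
    τ₀≡ = ≡ℓ-sym (≡ℓ-residue _)
    form≡ : ∀ σ → form r σ ≡ℓ (σ ⊖ τ₀) ⊗ (r ⊗ r)
    form≡ σ = ≡ℓ-intro (∣-respʳ (≋-sym (≋-trans (⊕-cong (form-≋ r σ) (≋-refl {⊝ ((σ ⊖ τ₀) ⊗ (r ⊗ r))}))
      (solve 5 (λ s t r a u → (s :* (r :* r) :- a :* a) :- (s :- t) :* (r :* r) :=
                 (t :- (u :* a) :* (u :* a)) :* (r :* r) :+ (a :* a) :* ((u :* r :- con (ℤ.+ 1)) :* (u :* r :+ con (ℤ.+ 1))))
             ≋-refl σ τ₀ r a u)))
      (∣-⊕ (∣-⊗ʳ (ℓ∣difference τ₀≡) (r ⊗ r)) (∣-⊗ˡ (∣-⊗ʳ ℓ∣ur-1 (u ⊗ r ⊕ oneP)) (a ⊗ a))))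
    ℓ∣form-τ₀ : ℓ ∣ form r τ₀
    ℓ∣form-τ₀ = ∣-resp-≡ℓ (≡ℓ-sym (form≡ τ₀)) (∣-respʳ (≋-sym (⊗-zeroˡ (⊕-inverseʳ τ₀) (r ⊗ r))) (∣-[] ℓ))
    ℓ∤τ₀ : ¬ ℓ ∣ τ₀
    ℓ∤τ₀ ℓ∣τ₀ = ℓ∤a (ℓ∣form⇒ℓ∣a r τ₀ (∣-⊗ʳ ℓ∣τ₀ (r ⊗ r)) ℓ∣form-τ₀)
    unitTerm-τ₀ : unitTerm τ₀ ≡ + 1
    unitTerm-τ₀ with ℓ∤? τ₀ | isSquare? τ₀
    ... | no ℓ∣τ₀ | _ = ⊥-elim (ℓ∣τ₀ ℓ∤τ₀)
    ... | yes _ | no ¬sq = ⊥-elim (¬sq ((λ p → ℓ∤τ₀ (∣P⇒∣ p)) , u ⊗ a , ≡ℓ-square⇒∣P τ₀ (u ⊗ a) τ₀≡))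
    ... | yes _ | yes _ = ℤ.^-zeroˡ k
    summand≡ : ∀ σ → σ ∈ Polys< d → summand r σ ≡ when (¬? (σ ≟P τ₀)) (unitTerm σ)
    summand≡ σ σ∈ = when-⇔ (ℓ∤? (form r σ)) (¬? (σ ≟P τ₀))
      (λ ℓ∤form σ≡τ₀ → ℓ∤form (subst (λ x → ℓ ∣ form r x) (sym σ≡τ₀) ℓ∣form-τ₀))
      (λ σ≢τ₀ ℓ∣form → σ≢τ₀ (≡ℓ⇒≡-Polys< σ∈ τ₀∈ (≡ℓ-intro (euclidsLemma (r ⊗ r) (σ ⊖ τ₀)
          (∣-respʳ (⊗-comm (σ ⊖ τ₀) (r ⊗ r)) (∣-resp-≡ℓ (form≡ σ) ℓ∣form)) (ℓ∤⊗ ℓ∤r ℓ∤r)))))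
      _

open import Data.Integer using (-_; _*_; _-_)

module CharacterSumValue (F : FiniteField) (q-odd : FiniteField.q F % 2 ≡ 1)
                         (coprime? : ∀ x v → Dec (Poly.Coprime F x v)) (χ : Poly.Pol F → Poly.Pol F → ℤ) (J : Poly.IsJacobi F χ)
                         (a : Poly.Pol F) {ℓ : Poly.Pol F} (ℓ-irr : Poly.MonicIrreducible F ℓ) (k : ℕ) where
  open CharacterSum F q-odd coprime? χ J a {ℓ} ℓ-irr (suc k) public

  c : Pol → ℤ
  c s = cSum coprime? χ a (ℓ ^P suc k) s

  unitSum : ℤ
  unitSum = ∑ unitTerm (Polys< d)

  c≡ : ∀ s → c s ≡ + (∣ ℓ ∣P ^ k) * ∑ (summand s) (Polys< d)
  c≡ s = begin
    c s                                                  ≡⟨ cSum≡∑summand s (s≤s z≤n) ⟩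
    ∑ (summand s) (Polys< (d ℕ.+ k ℕ.* d))               ≡⟨ ∑-Polys<-periodic (summand s) (summand-resp s) (k ℕ.* d) ⟩
    + (q ^ (k ℕ.* d)) * ∑ (summand s) (Polys< d)         ≡⟨ cong (λ n → + n * ∑ (summand s) (Polys< d)) q^kd≡|ℓ|^k ⟩
    + (∣ ℓ ∣P ^ k) * ∑ (summand s) (Polys< d)            ∎
    where
    open ≡-Reasoning
    q^kd≡|ℓ|^k : q ^ (k ℕ.* d) ≡ ∣ ℓ ∣P ^ k
    q^kd≡|ℓ|^k = trans (cong (q ^_) (ℕ.*-comm k d)) (sym (ℕ.^-*-assoc q d k))

  c-ℓ∣ : ∀ s → ℓ ∣ s → ¬ ℓ ∣ a → c s ≡ + (∣ ℓ ∣P ^ k) * unitSum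
  c-ℓ∣ s ℓ∣s ℓ∤a = trans (c≡ s) (cong (+ (∣ ℓ ∣P ^ k) *_) (∑-cong (Polys< d) λ σ _ → summand-ℓ∣r s ℓ∣s ℓ∤a σ))

  c-ℓ∣a : ∀ s → ¬ ℓ ∣ s → ℓ ∣ a → c s ≡ + (∣ ℓ ∣P ^ k) * unitSum
  c-ℓ∣a s ℓ∤s ℓ∣a = trans (c≡ s) (cong (+ (∣ ℓ ∣P ^ k) *_) (∑-cong (Polys< d) λ σ _ → summand-ℓ∣a s ℓ∤s ℓ∣a σ))

  c-ℓ∤ : ∀ s → ¬ ℓ ∣ s → ¬ ℓ ∣ a → c s ≡ + (∣ ℓ ∣P ^ k) * (unitSum - + 1)
  c-ℓ∤ s ℓ∤s ℓ∤a = trans (c≡ s) (cong (+ (∣ ℓ ∣P ^ k) *_) (∑summand-ℓ∤ra s ℓ∤s ℓ∤a))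

  c-ℓ∤-invariant : ∀ s s' → ¬ ℓ ∣ s → ¬ ℓ ∣ s' → c s ≡ c s'
  c-ℓ∤-invariant s s' ℓ∤s ℓ∤s' with ∣? a
  ... | yes ℓ∣a = trans (c-ℓ∣a s ℓ∤s ℓ∣a) (sym (c-ℓ∣a s' ℓ∤s' ℓ∣a))
  ... | no ℓ∤a = trans (c-ℓ∤ s ℓ∤s ℓ∤a) (sym (c-ℓ∤ s' ℓ∤s' ℓ∤a))

lemma5p1 : (F : FiniteField) → FiniteField.q F % 2 ≡ 1 →
    let open Poly F in
    (coprime? : ∀ x v → Dec (Coprime x v)) →
    (χ : Pol → Pol → ℤ) → IsJacobi χ →
    (a r ℓ : Pol) → Monic r → Coprime r a → MonicIrreducible ℓ →
    (k : ℕ) → 1 ≤ k →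
    let c = λ (s : Pol) → cSum coprime? χ a (ℓ ^P k) s in
    let L = ∣ ℓ ∣P in
    (ℓ ∣P r → c r ≡ c ℓ) ×
    (¬ (ℓ ∣P r) → c r ≡ c oneP) ×
    (k % 2 ≡ 0 → ¬ (ℓ ∣P a) → ¬ (ℓ ∣P r) → c r ≡ + (L ^ (k ∸ 1)) * (+ L - + 2)) ×
    (k % 2 ≡ 1 → ¬ (ℓ ∣P a) → ¬ (ℓ ∣P r) → c r ≡ - + (L ^ (k ∸ 1))) ×
    (k % 2 ≡ 0 → ℓ ∣P a → ¬ (ℓ ∣P r) → c r ≡ + (L ^ (k ∸ 1)) * (+ L - + 1)) ×
    (k % 2 ≡ 1 → ℓ ∣P a → ¬ (ℓ ∣P r) → c r ≡ + 0) ×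
    (k % 2 ≡ 0 → ℓ ∣P r → c r ≡ + (L ^ (k ∸ 1)) * (+ L - + 1)) ×
    (k % 2 ≡ 1 → ℓ ∣P r → c r ≡ + 0)
lemma5p1 F q-odd coprime? χ J a r ℓ _ r⊥a ℓ-irr (suc k) _ =
    (λ ℓ∣r → trans (c-ℓ∣ r (∣P⇒∣ ℓ∣r) (ℓ∤a ℓ∣r)) (sym (c-ℓ∣ ℓ (∣-refl ℓ) (ℓ∤a ℓ∣r))))
  , (λ ℓ∤r → c-ℓ∤-invariant r oneP (∤P⇒∤ ℓ∤r) ℓ∤oneP)
  , (λ even ℓ∤a ℓ∤r → trans (c-ℓ∤ r (∤P⇒∤ ℓ∤r) (∤P⇒∤ ℓ∤a))
                        (trans (cong (λ u → N * (u - + 1)) (∑unitTerm-even even)) (minus-two (+ L))))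
  , (λ odd ℓ∤a ℓ∤r → trans (c-ℓ∤ r (∤P⇒∤ ℓ∤r) (∤P⇒∤ ℓ∤a))
                       (trans (cong (λ u → N * (u - + 1)) (∑unitTerm-odd odd)) (times-minus-one N)))
  , (λ even ℓ∣a ℓ∤r → trans (c-ℓ∣a r (∤P⇒∤ ℓ∤r) (∣P⇒∣ ℓ∣a)) (cong (N *_) (∑unitTerm-even even)))
  , (λ odd ℓ∣a ℓ∤r → trans (c-ℓ∣a r (∤P⇒∤ ℓ∤r) (∣P⇒∣ ℓ∣a)) (N*-vanishes (∑unitTerm-odd odd)))
  , (λ even ℓ∣r → trans (c-ℓ∣ r (∣P⇒∣ ℓ∣r) (ℓ∤a ℓ∣r)) (cong (N *_) (∑unitTerm-even even)))
  , (λ odd ℓ∣r → trans (c-ℓ∣ r (∣P⇒∣ ℓ∣r) (ℓ∤a ℓ∣r)) (N*-vanishes (∑unitTerm-odd odd)))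
  where
  open CharacterSumValue F q-odd coprime? χ J a {ℓ} ℓ-irr k
  open +-*-Solver
  L = ∣ ℓ ∣P
  N = + (L ^ k)
  ∤P⇒∤ : ∀ {f} → ¬ (ℓ ∣P f) → ¬ ℓ ∣ f
  ∤P⇒∤ ℓ∤f ℓ∣f = ℓ∤f (∣⇒∣P ℓ∣f)
  ℓ∤a : ℓ ∣P r → ¬ ℓ ∣ a
  ℓ∤a ℓ∣r ℓ∣a = ℓ≉oneP (≈P⇒≋ (r⊥a ℓ (proj₁ ℓ-irr) ℓ∣r (∣⇒∣P ℓ∣a)))
  N*-vanishes : ∀ {x} → x ≡ + 0 → N * x ≡ + 0
  N*-vanishes refl = ℤ.*-zeroʳ N
  minus-two : ∀ x → N * (x - + 1 - + 1) ≡ N * (x - + 2)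
  minus-two = solve 1 (λ x → con N :* (x :- con (+ 1) :- con (+ 1)) := con N :* (x :- con (+ 2))) refl
  times-minus-one : ∀ x → x * (+ 0 - + 1) ≡ - x
  times-minus-one = solve 1 (λ x → x :* (con (+ 0) :- con (+ 1)) := :- x) refl
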